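{- There exists no sentence $\sigma$ of first-order logic over the vocabulary $\{D\}$ ($D$ a ternary relation symbol) such that, for every connected ternary structure $(X,D)$, $(X,D)$ is a $W$-structure if and only if $(X,D)$ satisfies $\sigma$.
   Context: A ternary structure is a pair $(X,D)$ with $X$ a finite nonempty set and $D\subseteq X^3$. Its underlying graph has vertex set $X$, distinct $u,v$ being adjacent iff $\{x\in X: D(u,x,v)\}\cup\{x\in X:D(v,x,u)\}=\{u,v\}$; the structure is connected if its underlying graph is connected. In a finite simple graph $G$, a walk $W=w_1w_2\cdots w_k$ ($k\ge 2$) is a toll walk if $w_1\neq w_k$, $w_2$ is the only neighbor of $w_1$ among the vertices of $W$, and $w_{k-1}$ is the only neighbor of $w_k$ among the vertices of $W$. The toll walk transit function $T$ of $G$ is given by $T(u,u)=\{u\}$ and, for $u\ne v$, $T(u,v)$ is the set of all vertices lying on some toll walk from $u$ to $v$. The $W$-structure of a graph $G$ is $(V(G),D)$ with $D(x,y,z)$ iff $y\in T(x,z)$; a ternary structure is a $W$-structure if it is the $W$-structure of some (finite, simple) graph. -}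

module Defs where

open import Data.Nat using (ℕ; zero; suc; _≤_)
open import Data.Fin using (Fin; zero; suc; _≟_)
open import Data.Bool using (Bool; true; false; _∧_; _∨_; not)
open import Data.List using (List; []; _∷_; reverse; allFin)
open import Data.Bool.ListAction using (all; any)
open import Data.List.Membership.Propositional using (_∈_)
open import Data.Product using (Σ; ∃; _×_; _,_)
open import Data.Sum using (_⊎_)
open import Data.Unit using (⊤)
open import Relation.Nullary using (¬_)
open import Relation.Nullary.Decidable using (⌊_⌋)
open import Relation.Binary.PropositionalEquality using (_≡_; _≢_)
open import Relation.Binary.Construct.Closure.ReflexiveTransitive using (Star)

-- Ternary structures: the finite nonempty carrier X is represented (up to
-- isomorphism) by Fin n with 1 ≤ n; the relation D ⊆ X³ by a Boolean
-- characteristic function.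

TRel : ℕ → Set
TRel n = Fin n → Fin n → Fin n → Bool

UAdj : ∀ {n} → TRel n → Fin n → Fin n → Set
UAdj D u v = u ≢ v × (∀ x → ((D u x v ≡ true ⊎ D v x u ≡ true) → (x ≡ u ⊎ x ≡ v))
                            × ((x ≡ u ⊎ x ≡ v) → (D u x v ≡ true ⊎ D v x u ≡ true)))

Connected : ∀ {n} → TRel n → Set
Connected D = ∀ u v → Star (UAdj D) u v

record Graph (n : ℕ) : Set where
  field
    adj    : Fin n → Fin n → Bool
    sym    : ∀ u v → adj u v ≡ adj v u
    irrefl : ∀ u → adj u u ≡ false
open Graph public

Chain : ∀ {n} → Graph n → List (Fin n) → Set
Chain G []            = ⊤
Chain G (x ∷ [])      = ⊤
Chain G (x ∷ y ∷ ws)  = (adj G x y ≡ true) × Chain G (y ∷ ws)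

TollWalk : ∀ {n} → Graph n → Fin n → Fin n → List (Fin n) → Set
TollWalk G u v W =
  Σ _ λ a → Σ _ λ b →
    (∃ λ t → W ≡ u ∷ a ∷ t) ×
    (∃ λ t → reverse W ≡ v ∷ b ∷ t) ×
    Chain G W ×
    u ≢ v ×
    (∀ x → x ∈ W → adj G u x ≡ true → x ≡ a) ×
    (∀ x → x ∈ W → adj G v x ≡ true → x ≡ b)

InT : ∀ {n} → Graph n → Fin n → Fin n → Fin n → Set
InT G u v y = (u ≡ v × y ≡ u) ⊎ (u ≢ v × ∃ λ W → TollWalk G u v W × y ∈ W)

IsWStructure : ∀ {n} → TRel n → Set
IsWStructure {n} D =
  Σ (Graph n) λ G → ∀ x y z → (D x y z ≡ true → InT G x z y) × (InT G x z y → D x y z ≡ true)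

-- First-order logic over the vocabulary {D} (with equality),
-- de Bruijn variables: Formula k has k free variables.

data Formula (k : ℕ) : Set where
  rel  : Fin k → Fin k → Fin k → Formula k
  eq   : Fin k → Fin k → Formula k
  ⊤f   : Formula k
  ⊥f   : Formula k
  ¬f   : Formula k → Formula k
  _∧f_ : Formula k → Formula k → Formula k
  _∨f_ : Formula k → Formula k → Formula k
  _⇒f_ : Formula k → Formula k → Formula k
  ∀f   : Formula (suc k) → Formula k
  ∃f   : Formula (suc k) → Formula k

Sentence : Set
Sentence = Formula 0

extend : ∀ {k n} → (Fin k → Fin n) → Fin n → Fin (suc k) → Fin n
extend ρ a zero    = a
extend ρ a (suc i) = ρ i

eval : ∀ {n k} → TRel n → Formula k → (Fin k → Fin n) → Bool
eval D (rel i j l) ρ = D (ρ i) (ρ j) (ρ l)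
eval D (eq i j)    ρ = ⌊ ρ i ≟ ρ j ⌋
eval D ⊤f          ρ = true
eval D ⊥f          ρ = false
eval D (¬f φ)      ρ = not (eval D φ ρ)
eval D (φ ∧f ψ)    ρ = eval D φ ρ ∧ eval D ψ ρ
eval D (φ ∨f ψ)    ρ = eval D φ ρ ∨ eval D ψ ρ
eval D (φ ⇒f ψ)    ρ = not (eval D φ ρ) ∨ eval D ψ ρ
eval {n} D (∀f φ)  ρ = all (λ a → eval D φ (extend ρ a)) (allFin n)
eval {n} D (∃f φ)  ρ = any (λ a → eval D φ (extend ρ a)) (allFin n)

noVars : ∀ {n} → Fin 0 → Fin n
noVars ()

_⊨_ : ∀ {n} → TRel n → Sentence → Set
D ⊨ σ = eval D σ noVars ≡ true

-- The relations Dn n are read off graphs H n: D(x,y,z) says y = x when x = z,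
-- y ∈ {x,z} when x and z are adjacent, and nothing otherwise.  For even n the
-- graph H n is a cycle with a hub in which every vertex lies on a toll walk
-- between any two non-adjacent vertices, so Dn n is the W-structure of H n.  For
-- odd n any graph realising Dn n must be H n, and there no toll walk from 0 to 3
-- passes through 4, so Dn n is not a W-structure.  Away from their ends H n and
-- H (n+1) both look like two interleaved paths i—i+2, so an Ehrenfeucht–Fraïssé
-- argument shows that Dn n and Dn (n+1) agree on sentences of quantifier depth d
-- once n is large compared with d.  A first-order definition of connected
-- W-structures would therefore hold in Dn (2m) and fail in Dn (2m+1).

module Submission where

open import Defs hiding (sym)
open import Data.Nat using (ℕ; zero; suc; _+_; _∸_; _≤_; _<_; z≤n; s≤s; _⊔_)
open import Data.Nat.Properties
import Data.Fin as F
open F using (Fin; zero; suc; toℕ; fromℕ<)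
open import Data.Fin.Properties using (toℕ-injective; toℕ<n; toℕ-fromℕ<)
open import Data.Bool using (Bool; true; false; T; _∧_; _∨_; not; if_then_else_)
open import Data.Bool.Properties using (⇔→≡; ∨-zeroʳ; not-involutive)
open import Data.Bool.ListAction using (all; any)
open import Data.List using (List; []; _∷_; _++_; reverse; map; allFin)
open import Data.List.Properties using (reverse-++; ++-assoc; reverse-map)
open import Data.List.Membership.Propositional using (_∈_; lose)
open import Data.List.Membership.Propositional.Properties using (∈-++⁻; ∈-++⁺ˡ; ∈-++⁺ʳ; ∈-map⁺; ∈-map⁻; ∈-allFin)
import Data.List.Relation.Unary.All as All
open import Data.List.Relation.Unary.All.Properties using (all⁺; all⁻)
open import Data.List.Relation.Unary.Any using (here; there; satisfied)
open import Data.List.Relation.Unary.Any.Properties using (any⁺; any⁻; reverse⁻)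
open import Data.Product using (Σ; ∃; _×_; _,_; proj₁; proj₂)
open import Data.Sum using (_⊎_; inj₁; inj₂; swap)
open import Data.Unit using (tt)
open import Data.Empty using (⊥-elim)
open import Function.Bundles using (_⇔_; mk⇔; Equivalence)
open import Relation.Nullary using (¬_; Dec; yes; no)
open import Relation.Nullary.Decidable using (⌊_⌋; _×-dec_; _⊎-dec_)
open import Relation.Binary.PropositionalEquality
open import Relation.Binary.Definitions using (tri<; tri≈; tri>)
open import Relation.Binary.Construct.Closure.ReflexiveTransitive as Star using (Star; ε; _◅_; _◅◅_)

true≢false : true ≢ false
true≢false ()

⌊⌋-true⁻ : ∀ {A : Set} (a? : Dec A) → ⌊ a? ⌋ ≡ true → A
⌊⌋-true⁻ (yes a) _ = a

⌊⌋-true : ∀ {A : Set} (a? : Dec A) → A → ⌊ a? ⌋ ≡ true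
⌊⌋-true (yes _) _ = refl
⌊⌋-true (no ¬a) a = ⊥-elim (¬a a)

⌊⌋-false : ∀ {A : Set} (a? : Dec A) → ¬ A → ⌊ a? ⌋ ≡ false
⌊⌋-false (yes a) ¬a = ⊥-elim (¬a a)
⌊⌋-false (no _) _ = refl

⌊⌋-cong : ∀ {A B : Set} (a? : Dec A) (b? : Dec B) → A ⇔ B → ⌊ a? ⌋ ≡ ⌊ b? ⌋
⌊⌋-cong a? b? A⇔B = ⇔→≡ {z = true} (mk⇔ (λ e → ⌊⌋-true b? (to (⌊⌋-true⁻ a? e)))
                                         (λ e → ⌊⌋-true a? (from (⌊⌋-true⁻ b? e))))
  where open Equivalence A⇔B

∨-true⁻ : ∀ {a b : Bool} → (a ∨ b) ≡ true → a ≡ true ⊎ b ≡ true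
∨-true⁻ {true} _ = inj₁ refl
∨-true⁻ {false} e = inj₂ e

-- Toll walks

module TollWalks {n : ℕ} (G : Graph n) where

  infix 4 _~_
  _~_ : Fin n → Fin n → Set
  x ~ y = adj G x y ≡ true

  ~-sym : ∀ {x y} → x ~ y → y ~ x
  ~-sym {x} {y} e = trans (Graph.sym G y x) e

  ~-irrefl : ∀ {x} → ¬ x ~ x
  ~-irrefl {x} e = true≢false (trans (sym e) (irrefl G x))

  Chain-invariant : (P : Fin n → Set) → ∀ h L → Chain G (h ∷ L) → P h →
    (∀ {x y} → P x → x ~ y → y ∈ h ∷ L → P y) → ∀ {y} → y ∈ h ∷ L → P y
  Chain-invariant P h L c ph step (here refl) = ph
  Chain-invariant P h (x ∷ L) (h~x , c) ph step (there y∈L) =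
    Chain-invariant P x L c (step ph h~x (there (here refl))) (λ px x~y y∈ → step px x~y (there y∈)) y∈L

  tollWalk-invariant : ∀ {u v W} → TollWalk G u v W → (P : Fin n → Set) → P u →
    (∀ {x y} → P x → x ~ y → y ∈ W → P y) → ∀ {y} → y ∈ W → P y
  tollWalk-invariant (a , b , (t , refl) , _ , ch , _) P pu step = Chain-invariant P _ (a ∷ t) ch pu step

  last∈tollWalk : ∀ {u v W} → TollWalk G u v W → v ∈ W
  last∈tollWalk (_ , _ , _ , (_ , rev≡) , _) = reverse⁻ (subst (_ ∈_) (sym rev≡) (here refl))

  -- v lies on the walk, so it is the only neighbour of u there, and vice versa.
  tollWalk-adjacent : ∀ {u v W} → u ~ v → TollWalk G u v W → ∀ {y} → y ∈ W → y ≡ u ⊎ y ≡ v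
  tollWalk-adjacent {u} {v} {W} u~v tw@(a , b , (_ , refl) , _ , _ , _ , only-a , only-b) =
    tollWalk-invariant tw (λ x → x ≡ u ⊎ x ≡ v) (inj₁ refl) step
    where
      step : ∀ {x y} → x ≡ u ⊎ x ≡ v → x ~ y → y ∈ W → y ≡ u ⊎ y ≡ v
      step (inj₁ refl) x~y y∈W = inj₂ (trans (only-a _ y∈W x~y) (sym (only-a v (last∈tollWalk tw) u~v)))
      step (inj₂ refl) x~y y∈W = inj₁ (trans (only-b _ y∈W x~y) (sym (only-b u (here refl) (~-sym u~v))))

  Admissible : (u v a b : Fin n) → Fin n → Set
  Admissible u v a b x = (u ~ x → x ≡ a) × (v ~ x → x ≡ b)

  module Within (A : Fin n → Set) where

    Step : Fin n → Fin n → Set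
    Step p q = p ~ q × A p × A q

    vertices : ∀ {x y} → Star Step x y → List (Fin n)
    vertices {x} ε = x ∷ []
    vertices {x} (_ ◅ s) = x ∷ vertices s

    vertices-head : ∀ {x y} (s : Star Step x y) → ∃ λ t → vertices s ≡ x ∷ t
    vertices-head ε = [] , refl
    vertices-head (_ ◅ s) = vertices s , refl

    vertices-last : ∀ {x y} (s : Star Step x y) → ∃ λ I → vertices s ≡ I ++ y ∷ []
    vertices-last ε = [] , refl
    vertices-last {x} (_ ◅ s) with vertices-last s
    ... | I , s≡ = x ∷ I , cong (x ∷_) s≡

    vertices-within : ∀ {x y} (s : Star Step x y) → A x → ∀ {z} → z ∈ vertices s → A z
    vertices-within ε ax (here refl) = ax
    vertices-within (_ ◅ s) ax (here refl) = ax
    vertices-within (r ◅ s) ax (there z∈) = vertices-within s (proj₂ (proj₂ r)) z∈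

    vertices-chain : ∀ {x y v} (s : Star Step x y) → y ~ v → Chain G (vertices s ++ v ∷ [])
    vertices-chain ε y~v = y~v , tt
    vertices-chain (r ◅ ε) y~v = proj₁ r , y~v , tt
    vertices-chain (r ◅ r′ ◅ s) y~v = proj₁ r , vertices-chain (r′ ◅ s) y~v

    first∈vertices : ∀ {x y} (s : Star Step x y) → x ∈ vertices s
    first∈vertices ε = here refl
    first∈vertices (_ ◅ s) = here refl

    middle∈vertices : ∀ {x y z} (s : Star Step x y) (t : Star Step y z) → y ∈ vertices (s ◅◅ t)
    middle∈vertices ε t = first∈vertices t
    middle∈vertices (_ ◅ s) t = there (middle∈vertices s t)

  -- u a … b v is a toll walk once a … b avoids all other neighbours of u and v.
  InT-admissible-path : ∀ {u v a b} → u ≢ v → adj G u v ≡ false → u ~ a → v ~ b →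
    Admissible u v a b a → (s : Star (Within.Step (Admissible u v a b)) a b) →
    ∀ {y} → y ∈ u ∷ (Within.vertices (Admissible u v a b) s ++ v ∷ []) → InT G u v y
  InT-admissible-path {u} {v} {a} {b} u≢v u≁v u~a v~b adm-a s y∈W =
    inj₂ (u≢v , W , (a , b , (t ++ v ∷ [] , cong (λ w → u ∷ w ++ v ∷ []) head≡) ,
         (reverse (u ∷ I) , reverse≡) , chainW , u≢v , only-a , only-b) , y∈W)
    where
      open Within (Admissible u v a b)
      W : List (Fin n)
      W = u ∷ (vertices s ++ v ∷ [])
      t : List (Fin n)
      t = proj₁ (vertices-head s)
      head≡ : vertices s ≡ a ∷ t
      head≡ = proj₂ (vertices-head s)
      I : List (Fin n)
      I = proj₁ (vertices-last s)
      last≡ : vertices s ≡ I ++ b ∷ []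
      last≡ = proj₂ (vertices-last s)

      reverse≡ : reverse W ≡ v ∷ b ∷ reverse (u ∷ I)
      reverse≡ = begin
        reverse (u ∷ (vertices s ++ v ∷ []))      ≡⟨ cong (λ w → reverse (u ∷ (w ++ v ∷ []))) last≡ ⟩
        reverse (u ∷ ((I ++ b ∷ []) ++ v ∷ []))   ≡⟨ cong (λ w → reverse (u ∷ w)) (++-assoc I (b ∷ []) (v ∷ [])) ⟩
        reverse ((u ∷ I) ++ b ∷ v ∷ [])           ≡⟨ reverse-++ (u ∷ I) (b ∷ v ∷ []) ⟩
        v ∷ b ∷ reverse (u ∷ I)                   ∎
        where open ≡-Reasoning

      chainW : Chain G W
      chainW with vertices s | head≡ | vertices-chain {v = v} s (~-sym v~b)
      ... | _ | refl | c = u~a , c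

      split : ∀ {x} → x ∈ W → x ≡ u ⊎ x ∈ vertices s ⊎ x ≡ v
      split (here x≡u) = inj₁ x≡u
      split (there x∈) with ∈-++⁻ (vertices s) x∈
      ... | inj₁ x∈s = inj₂ (inj₁ x∈s)
      ... | inj₂ (here x≡v) = inj₂ (inj₂ x≡v)

      only-a : ∀ x → x ∈ W → u ~ x → x ≡ a
      only-a x x∈ u~x with split x∈
      ... | inj₁ refl = ⊥-elim (~-irrefl u~x)
      ... | inj₂ (inj₁ x∈s) = proj₁ (vertices-within s adm-a x∈s) u~x
      ... | inj₂ (inj₂ refl) = ⊥-elim (true≢false (trans (sym u~x) u≁v))

      only-b : ∀ x → x ∈ W → v ~ x → x ≡ b
      only-b x x∈ v~x with split x∈
      ... | inj₁ refl = ⊥-elim (true≢false (trans (sym (~-sym v~x)) u≁v))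
      ... | inj₂ (inj₁ x∈s) = proj₂ (vertices-within s adm-a x∈s) v~x
      ... | inj₂ (inj₂ refl) = ⊥-elim (~-irrefl v~x)

TollSpanning : ∀ {n} → Graph n → Set
TollSpanning G = ∀ {u v} → u ≢ v → adj G u v ≡ false → ∀ y → InT G u v y

module Transport {n n′ : ℕ} (G : Graph n) (G′ : Graph n′) (π : Fin n → Fin n′)
  (π-adj : ∀ x y → adj G′ (π x) (π y) ≡ adj G x y) (π-injective : ∀ {x y} → π x ≡ π y → x ≡ y) where

  Chain-map : ∀ L → Chain G L → Chain G′ (map π L)
  Chain-map [] _ = tt
  Chain-map (_ ∷ []) _ = tt
  Chain-map (x ∷ y ∷ L) (x~y , c) = trans (π-adj x y) x~y , Chain-map (y ∷ L) c

  InT-transport : ∀ {u v y} → InT G u v y → InT G′ (π u) (π v) (π y)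
  InT-transport (inj₁ (refl , refl)) = inj₁ (refl , refl)
  InT-transport {u} {v} (inj₂ (u≢v , W , (a , b , (t , refl) , (t′ , rev≡) , ch , _ , only-a , only-b) , y∈W)) =
    inj₂ (πu≢πv , map π W , (π a , π b , (map π t , refl) ,
      (map π t′ , trans (sym (reverse-map π W)) (cong (map π) rev≡)) ,
      Chain-map W ch , πu≢πv , only only-a , only only-b) , ∈-map⁺ π y∈W)
    where
      πu≢πv : π u ≢ π v
      πu≢πv πu≡πv = u≢v (π-injective πu≡πv)
      only : ∀ {w c} → (∀ x → x ∈ W → adj G w x ≡ true → x ≡ c) →
             ∀ x → x ∈ map π W → adj G′ (π w) x ≡ true → x ≡ π c
      only {w} h x x∈ w~x with ∈-map⁻ π x∈
      ... | x′ , x′∈ , refl = cong π (h x′ x′∈ (trans (sym (π-adj w x′)) w~x))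

  TollSpanning-transport : (ψ : Fin n′ → Fin n) → (∀ x → π (ψ x) ≡ x) → TollSpanning G → TollSpanning G′
  TollSpanning-transport ψ π∘ψ spanning {u} {v} u≢v u≁v y
    with InT-transport (spanning (λ e → u≢v (π∘ψ⇒≡ e)) ψu≁ψv (ψ y))
    where
      π∘ψ⇒≡ : ψ u ≡ ψ v → u ≡ v
      π∘ψ⇒≡ e = trans (sym (π∘ψ u)) (trans (cong π e) (π∘ψ v))
      ψu≁ψv : adj G (ψ u) (ψ v) ≡ false
      ψu≁ψv = trans (sym (π-adj (ψ u) (ψ v))) (trans (cong₂ (adj G′) (π∘ψ u) (π∘ψ v)) u≁v)
  ... | t rewrite π∘ψ u | π∘ψ v | π∘ψ y = t

-- The relations Dn n

Local : ℕ → ℕ → Set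
Local i j = (2 + i ≡ j) ⊎ (2 + j ≡ i) ⊎ (i ≡ 0 × j ≡ 1) ⊎ (j ≡ 0 × i ≡ 1)

Closing : ℕ → ℕ → ℕ → Set
Closing n i j = (i ≡ 1 × 2 + j ≡ n) ⊎ (i ≡ 2 × 1 + j ≡ n)

-- For odd n
-- it is two cycles (odd vertices; even vertices ≥ 2) joined through 0; for
-- even n it is one cycle through 1 … n−1 with 0 attached to 1 and 2.
Edge : ℕ → ℕ → ℕ → Set
Edge n i j = Local i j ⊎ Closing n i j ⊎ Closing n j i

Edge? : ∀ n i j → Dec (Edge n i j)
Edge? n i j =
  ((2 + i ≟ j) ⊎-dec (2 + j ≟ i) ⊎-dec ((i ≟ 0) ×-dec (j ≟ 1)) ⊎-dec ((j ≟ 0) ×-dec (i ≟ 1)))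
  ⊎-dec (((i ≟ 1) ×-dec (2 + j ≟ n)) ⊎-dec ((i ≟ 2) ×-dec (1 + j ≟ n)))
  ⊎-dec (((j ≟ 1) ×-dec (2 + i ≟ n)) ⊎-dec ((j ≟ 2) ×-dec (1 + i ≟ n)))

Local-sym : ∀ {i j} → Local i j → Local j i
Local-sym (inj₁ e) = inj₂ (inj₁ e)
Local-sym (inj₂ (inj₁ e)) = inj₁ e
Local-sym (inj₂ (inj₂ (inj₁ e))) = inj₂ (inj₂ (inj₂ e))
Local-sym (inj₂ (inj₂ (inj₂ e))) = inj₂ (inj₂ (inj₁ e))

Edge-sym : ∀ {n i j} → Edge n i j → Edge n j i
Edge-sym (inj₁ l) = inj₁ (Local-sym l)
Edge-sym (inj₂ (inj₁ c)) = inj₂ (inj₂ c)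
Edge-sym (inj₂ (inj₂ c)) = inj₂ (inj₁ c)

Edge-irrefl : ∀ {n i} → 4 ≤ n → ¬ Edge n i i
Edge-irrefl {i = i} _ (inj₁ (inj₁ e)) = <-irrefl (sym e) (s≤s (n≤1+n i))
Edge-irrefl {i = i} _ (inj₁ (inj₂ (inj₁ e))) = <-irrefl (sym e) (s≤s (n≤1+n i))
Edge-irrefl _ (inj₁ (inj₂ (inj₂ (inj₁ (refl , ())))))
Edge-irrefl _ (inj₁ (inj₂ (inj₂ (inj₂ (refl , ())))))
Edge-irrefl 4≤n (inj₂ (inj₁ (inj₁ (refl , e)))) = <-irrefl e 4≤n
Edge-irrefl 4≤n (inj₂ (inj₁ (inj₂ (refl , e)))) = <-irrefl e 4≤n
Edge-irrefl 4≤n (inj₂ (inj₂ (inj₁ (refl , e)))) = <-irrefl e 4≤n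
Edge-irrefl 4≤n (inj₂ (inj₂ (inj₂ (refl , e)))) = <-irrefl e 4≤n

edge : ∀ n → Fin n → Fin n → Bool
edge n x y = ⌊ Edge? n (toℕ x) (toℕ y) ⌋

edge⁻ : ∀ {n} {x y : Fin n} → edge n x y ≡ true → Edge n (toℕ x) (toℕ y)
edge⁻ = ⌊⌋-true⁻ (Edge? _ _ _)

edge⁺ : ∀ {n} {x y : Fin n} → Edge n (toℕ x) (toℕ y) → edge n x y ≡ true
edge⁺ = ⌊⌋-true (Edge? _ _ _)

non-edge⁺ : ∀ {n} {x y : Fin n} → ¬ Edge n (toℕ x) (toℕ y) → edge n x y ≡ false
non-edge⁺ = ⌊⌋-false (Edge? _ _ _)

H : ∀ n → 4 ≤ n → Graph n
H n 4≤n = record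
  { adj = edge n
  ; sym = λ x y → ⌊⌋-cong (Edge? _ _ _) (Edge? _ _ _) (mk⇔ Edge-sym Edge-sym)
  ; irrefl = λ x → non-edge⁺ (Edge-irrefl 4≤n) }

infix 6 _==_
_==_ : ∀ {n} → Fin n → Fin n → Bool
x == y = ⌊ x F.≟ y ⌋

==-refl : ∀ {n} (x : Fin n) → (x == x) ≡ true
==-refl x = ⌊⌋-true (x F.≟ x) refl

==-false : ∀ {n} {x y : Fin n} → x ≢ y → (x == y) ≡ false
==-false = ⌊⌋-false (_ F.≟ _)

==⁻ : ∀ {n} {x y : Fin n} → (x == y) ≡ true → x ≡ y
==⁻ = ⌊⌋-true⁻ (_ F.≟ _)

-- The W-structure a graph with adjacency e would have if every vertex lay on a
-- toll walk between any two distinct non-adjacent vertices.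
D[_] : ∀ {n} → (Fin n → Fin n → Bool) → TRel n
D[ e ] x y z = if x == z then y == x else (if e x z then (y == x ∨ y == z) else true)

Dn : ∀ n → TRel n
Dn n = D[ edge n ]

D-adjacent : ∀ {n} (e : Fin n → Fin n → Bool) {x z : Fin n} (y : Fin n) → x ≢ z → e x z ≡ true →
  D[ e ] x y z ≡ (y == x ∨ y == z)
D-adjacent e y x≢z exz rewrite ==-false x≢z | exz = refl

D-nonadjacent : ∀ {n} (e : Fin n → Fin n → Bool) {x z : Fin n} (y : Fin n) → x ≢ z → e x z ≡ false →
  D[ e ] x y z ≡ true
D-nonadjacent e y x≢z exz rewrite ==-false x≢z | exz = refl

RealizesW : ∀ {n} → Graph n → TRel n → Set
RealizesW G D = ∀ x y z → (D x y z ≡ true → InT G x z y) × (InT G x z y → D x y z ≡ true)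

RealizesW-D : ∀ {n} (G : Graph n) → TollSpanning G → RealizesW G D[ adj G ]
RealizesW-D G spanning x y z with x F.≟ z | adj G x z in x~?z
... | yes refl | _ = (λ y≡x → inj₁ (refl , ==⁻ y≡x)) , diagonal
  where
    diagonal : InT G x x y → (y == x) ≡ true
    diagonal (inj₁ (_ , refl)) = ==-refl y
    diagonal (inj₂ (x≢x , _)) = ⊥-elim (x≢x refl)
... | no x≢z | false = (λ _ → spanning x≢z x~?z y) , (λ _ → refl)
... | no x≢z | true = to , from
  where
    open TollWalks G
    to : (y == x ∨ y == z) ≡ true → InT G x z y
    to d = inj₂ (x≢z , x ∷ z ∷ [] , (z , x , ([] , refl) , ([] , refl) , (x~?z , tt) , x≢z , only-z , only-x) , y∈ (∨-true⁻ d))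
      where
        y∈ : (y == x) ≡ true ⊎ (y == z) ≡ true → y ∈ x ∷ z ∷ []
        y∈ (inj₁ y≡x) = here (==⁻ y≡x)
        y∈ (inj₂ y≡z) = there (here (==⁻ y≡z))
        only-z : ∀ w → w ∈ x ∷ z ∷ [] → x ~ w → w ≡ z
        only-z w (here refl) x~x = ⊥-elim (~-irrefl x~x)
        only-z w (there (here refl)) _ = refl
        only-x : ∀ w → w ∈ x ∷ z ∷ [] → z ~ w → w ≡ x
        only-x w (here refl) _ = refl
        only-x w (there (here refl)) z~z = ⊥-elim (~-irrefl z~z)
    from : InT G x z y → (y == x ∨ y == z) ≡ true
    from (inj₁ (x≡z , _)) = ⊥-elim (x≢z x≡z)
    from (inj₂ (_ , W , tw , y∈W)) with tollWalk-adjacent x~?z tw y∈W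
    ... | inj₁ refl = cong (_∨ (y == z)) (==-refl y)
    ... | inj₂ refl = trans (cong ((y == x) ∨_) (==-refl y)) (∨-zeroʳ (y == x))

UAdj-D : ∀ {n} (G : Graph n) {u v : Fin n} → adj G u v ≡ true → UAdj D[ adj G ] u v
UAdj-D G {u} {v} u~v = u≢v , λ x → only x , ends x
  where
    open TollWalks G
    u≢v : u ≢ v
    u≢v refl = ~-irrefl u~v
    Duv : ∀ x → D[ adj G ] u x v ≡ (x == u ∨ x == v)
    Duv x = D-adjacent (adj G) x u≢v u~v
    Dvu : ∀ x → D[ adj G ] v x u ≡ (x == v ∨ x == u)
    Dvu x = D-adjacent (adj G) x (≢-sym u≢v) (~-sym u~v)
    only : ∀ x → D[ adj G ] u x v ≡ true ⊎ D[ adj G ] v x u ≡ true → x ≡ u ⊎ x ≡ v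
    only x (inj₁ d) with ∨-true⁻ (trans (sym (Duv x)) d)
    ... | inj₁ x≡u = inj₁ (==⁻ x≡u)
    ... | inj₂ x≡v = inj₂ (==⁻ x≡v)
    only x (inj₂ d) with ∨-true⁻ (trans (sym (Dvu x)) d)
    ... | inj₁ x≡v = inj₂ (==⁻ x≡v)
    ... | inj₂ x≡u = inj₁ (==⁻ x≡u)
    ends : ∀ x → x ≡ u ⊎ x ≡ v → D[ adj G ] u x v ≡ true ⊎ D[ adj G ] v x u ≡ true
    ends x (inj₁ refl) = inj₁ (trans (Duv x) (cong (_∨ (x == v)) (==-refl x)))
    ends x (inj₂ refl) = inj₂ (trans (Dvu x) (cong (_∨ (x == u)) (==-refl x)))

UAdj-sym : ∀ {n} {D : TRel n} {u v} → UAdj D u v → UAdj D v u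
UAdj-sym (u≢v , h) = (λ e → u≢v (sym e)) , λ x → (λ d → swap (proj₁ (h x) (swap d))) , (λ d → swap (proj₂ (h x) (swap d)))

Dn-connected : ∀ {n} → 4 ≤ n → Connected (Dn n)
Dn-connected {n@(suc _)} 4≤n u v = to-0 u ◅◅ Star.reverse (UAdj-sym {D = Dn n}) (to-0 v)
  where
    down : ∀ k (k<n : k < n) → Star (UAdj (Dn n)) (fromℕ< k<n) zero
    down zero _ = ε
    down (suc zero) 1<n =
      UAdj-D (H n 4≤n) (edge⁺ (subst₂ (Edge n) (sym (toℕ-fromℕ< 1<n)) refl (inj₁ (inj₂ (inj₂ (inj₂ (refl , refl))))))) ◅ ε
    down (suc (suc k)) k+2<n =
      UAdj-D (H n 4≤n) {v = fromℕ< k<n}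
        (edge⁺ (subst₂ (Edge n) (sym (toℕ-fromℕ< k+2<n)) (sym (toℕ-fromℕ< k<n)) (inj₁ (inj₂ (inj₁ refl)))))
      ◅ down k k<n
      where k<n : k < n
            k<n = <-trans (n<1+n k) (<-trans (n<1+n (suc k)) k+2<n)
    to-0 : ∀ x → Star (UAdj (Dn n)) x zero
    to-0 x = subst (λ w → Star (UAdj (Dn n)) w zero) (toℕ-injective (toℕ-fromℕ< (toℕ<n x))) (down (toℕ x) (toℕ<n x))

-- Dn n and Dn (n+1) agree on sentences of bounded depth

T-ext : ∀ {x y : Bool} → (T x → T y) → (T y → T x) → x ≡ y
T-ext {false} {false} _ _ = refl
T-ext {false} {true} _ g = ⊥-elim (g _)
T-ext {true} {false} f _ = ⊥-elim (f _)
T-ext {true} {true} _ _ = refl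

Covers : ∀ {n m} → (Fin n → Bool) → (Fin m → Bool) → Set
Covers f h = ∀ b → ∃ λ a → h b ≡ f a

BackAndForth : ∀ {n m} → (Fin n → Bool) → (Fin m → Bool) → Set
BackAndForth f h = Covers h f × Covers f h

all-cover : ∀ {n m} {f : Fin n → Bool} {h : Fin m → Bool} → Covers f h →
  T (all f (allFin n)) → T (all h (allFin m))
all-cover {n} {m} {f} {h} cover t = all⁻ h {allFin m} (All.tabulate λ {b} _ →
  subst T (sym (proj₂ (cover b))) (All.lookup (all⁺ f (allFin n) t) (∈-allFin (proj₁ (cover b)))))

any-cover : ∀ {n m} {f : Fin n → Bool} {h : Fin m → Bool} → Covers h f →
  T (any f (allFin n)) → T (any h (allFin m))
any-cover {n} {m} {f} {h} cover t with satisfied (any⁻ f (allFin n) t)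
... | a , ta with cover a
... | b , fa≡hb = any⁺ h (lose {xs = allFin m} (∈-allFin b) (subst T fa≡hb ta))

all-allFin-cong : ∀ {n m} {f : Fin n → Bool} {h : Fin m → Bool} →
  BackAndForth f h → all f (allFin n) ≡ all h (allFin m)
all-allFin-cong (forth , back) = T-ext (all-cover back) (all-cover forth)

any-allFin-cong : ∀ {n m} {f : Fin n → Bool} {h : Fin m → Bool} →
  BackAndForth f h → any f (allFin n) ≡ any h (allFin m)
any-allFin-cong (forth , back) = T-ext (any-cover forth) (any-cover back)

-- Matching H n with H (n+1) by shifting everything from g + L on up by one.
-- A gap of width L ≥ 2 keeps every i—i+2 edge on one side, and the closing
-- edges only involve 1, 2 and the last two vertices, so the matching is a
-- partial isomorphism (Edge-matched).
Matched : (g L x y : ℕ) → Set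
Matched g L x y = (x < g × y ≡ x) ⊎ (g + L ≤ x × y ≡ suc x)

record Gap (n g L : ℕ) : Set where
  field
    3≤g : 3 ≤ g
    g+L+2≤n : 2 + (g + L) ≤ n
    2≤L : 2 ≤ L

¬Closing-low : ∀ {n i j} → 2 + j < n → ¬ Closing n i j
¬Closing-low j+2<n (inj₁ (_ , refl)) = <-irrefl refl j+2<n
¬Closing-low j+2<n (inj₂ (_ , refl)) = <⇒≱ j+2<n (n≤1+n _)

¬Closing-high : ∀ {n i j} → 3 ≤ i → ¬ Closing n i j
¬Closing-high {i = 1} (s≤s ()) (inj₁ (refl , _))
¬Closing-high {i = 2} (s≤s (s≤s ())) (inj₂ (refl , _))

Local-suc : ∀ {i j} → 1 ≤ i → 1 ≤ j → Local i j → Local (suc i) (suc j)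
Local-suc _ _ (inj₁ e) = inj₁ (cong suc e)
Local-suc _ _ (inj₂ (inj₁ e)) = inj₂ (inj₁ (cong suc e))
Local-suc (s≤s _) _ (inj₂ (inj₂ (inj₁ (() , _))))
Local-suc _ (s≤s _) (inj₂ (inj₂ (inj₂ (() , _))))

Local-suc⁻ : ∀ {i j} → Local (suc i) (suc j) → Local i j
Local-suc⁻ (inj₁ e) = inj₁ (suc-injective e)
Local-suc⁻ (inj₂ (inj₁ e)) = inj₂ (inj₁ (suc-injective e))
Local-suc⁻ (inj₂ (inj₂ (inj₁ (() , _))))
Local-suc⁻ (inj₂ (inj₂ (inj₂ (() , _))))

¬Local-far : ∀ {i j} → 2 + i < j → ¬ Local i j
¬Local-far i+2<j (inj₁ refl) = <-irrefl refl i+2<j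
¬Local-far {j = j} i+2<j (inj₂ (inj₁ refl)) = <-irrefl refl (≤-trans i+2<j (m≤n+m j 4))
¬Local-far {0} {1} (s≤s ()) (inj₂ (inj₂ (inj₁ (refl , refl))))
¬Local-far {1} {0} () (inj₂ (inj₂ (inj₂ (refl , refl))))

module _ {n g L : ℕ} (gap : Gap n g L) where
  open Gap gap

  low+2<n : ∀ {x} → x < g → 2 + x < n
  low+2<n x<g = ≤-trans (s≤s (s≤s x<g)) (≤-trans (+-monoʳ-≤ 2 (m≤m+n g L)) g+L+2≤n)

  3≤high : ∀ {x} → g + L ≤ x → 3 ≤ x
  3≤high g+L≤x = ≤-trans 3≤g (≤-trans (m≤m+n _ L) g+L≤x)

  low+2<high : ∀ {x x′} → x < g → g + L ≤ x′ → 2 + x < x′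
  low+2<high x<g g+L≤x′ =
    ≤-trans (s≤s (s≤s x<g)) (≤-trans (≤-reflexive (+-comm 2 g)) (≤-trans (+-monoʳ-≤ g 2≤L) g+L≤x′))

  low≮high : ∀ {x} → x < g → ¬ (g + L ≤ x)
  low≮high x<g g+L≤x = <-irrefl refl (≤-trans x<g (≤-trans (m≤m+n _ L) g+L≤x))

  Edge-low-low : ∀ {x x′} → x < g → x′ < g → Edge n x x′ ⇔ Edge (suc n) x x′
  Edge-low-low {x} {x′} x<g x′<g = mk⇔ to from
    where
      to : Edge n x x′ → Edge (suc n) x x′
      to (inj₁ l) = inj₁ l
      to (inj₂ (inj₁ c)) = ⊥-elim (¬Closing-low (low+2<n x′<g) c)
      to (inj₂ (inj₂ c)) = ⊥-elim (¬Closing-low (low+2<n x<g) c)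
      from : Edge (suc n) x x′ → Edge n x x′
      from (inj₁ l) = inj₁ l
      from (inj₂ (inj₁ c)) = ⊥-elim (¬Closing-low (m≤n⇒m≤1+n (low+2<n x′<g)) c)
      from (inj₂ (inj₂ c)) = ⊥-elim (¬Closing-low (m≤n⇒m≤1+n (low+2<n x<g)) c)

  Edge-high-high : ∀ {x x′} → g + L ≤ x → g + L ≤ x′ → Edge n x x′ ⇔ Edge (suc n) (suc x) (suc x′)
  Edge-high-high {x} {x′} hx hx′ = mk⇔ to from
    where
      to : Edge n x x′ → Edge (suc n) (suc x) (suc x′)
      to (inj₁ l) = inj₁ (Local-suc (≤-trans (s≤s z≤n) (3≤high hx)) (≤-trans (s≤s z≤n) (3≤high hx′)) l)
      to (inj₂ (inj₁ c)) = ⊥-elim (¬Closing-high (3≤high hx) c)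
      to (inj₂ (inj₂ c)) = ⊥-elim (¬Closing-high (3≤high hx′) c)
      from : Edge (suc n) (suc x) (suc x′) → Edge n x x′
      from (inj₁ l) = inj₁ (Local-suc⁻ l)
      from (inj₂ (inj₁ c)) = ⊥-elim (¬Closing-high (m≤n⇒m≤1+n (3≤high hx)) c)
      from (inj₂ (inj₂ c)) = ⊥-elim (¬Closing-high (m≤n⇒m≤1+n (3≤high hx′)) c)

  Edge-low-high : ∀ {x x′} → x < g → g + L ≤ x′ → Edge n x x′ ⇔ Edge (suc n) x (suc x′)
  Edge-low-high {x} {x′} x<g hx′ = mk⇔ to from
    where
      to : Edge n x x′ → Edge (suc n) x (suc x′)
      to (inj₁ l) = ⊥-elim (¬Local-far (low+2<high x<g hx′) l)
      to (inj₂ (inj₁ (inj₁ (e , e′)))) = inj₂ (inj₁ (inj₁ (e , cong suc e′)))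
      to (inj₂ (inj₁ (inj₂ (e , e′)))) = inj₂ (inj₁ (inj₂ (e , cong suc e′)))
      to (inj₂ (inj₂ c)) = ⊥-elim (¬Closing-high (3≤high hx′) c)
      from : Edge (suc n) x (suc x′) → Edge n x x′
      from (inj₁ l) = ⊥-elim (¬Local-far (m≤n⇒m≤1+n (low+2<high x<g hx′)) l)
      from (inj₂ (inj₁ (inj₁ (e , e′)))) = inj₂ (inj₁ (inj₁ (e , suc-injective e′)))
      from (inj₂ (inj₁ (inj₂ (e , e′)))) = inj₂ (inj₁ (inj₂ (e , suc-injective e′)))
      from (inj₂ (inj₂ c)) = ⊥-elim (¬Closing-high (m≤n⇒m≤1+n (3≤high hx′)) c)

  Edge-matched : ∀ {x y x′ y′} → Matched g L x y → Matched g L x′ y′ → Edge n x x′ ⇔ Edge (suc n) y y′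
  Edge-matched (inj₁ (x<g , refl)) (inj₁ (x′<g , refl)) = Edge-low-low x<g x′<g
  Edge-matched (inj₂ (hx , refl)) (inj₂ (hx′ , refl)) = Edge-high-high hx hx′
  Edge-matched (inj₁ (x<g , refl)) (inj₂ (hx′ , refl)) = Edge-low-high x<g hx′
  Edge-matched (inj₂ (hx , refl)) (inj₁ (x′<g , refl)) =
    mk⇔ (λ e → Edge-sym (to (Edge-sym e))) (λ e → Edge-sym (from (Edge-sym e)))
    where open Equivalence (Edge-low-high x′<g hx)

  ≡-matched : ∀ {x y x′ y′} → Matched g L x y → Matched g L x′ y′ → (x ≡ x′) ⇔ (y ≡ y′)
  ≡-matched (inj₁ (_ , refl)) (inj₁ (_ , refl)) = mk⇔ (λ e → e) (λ e → e)
  ≡-matched (inj₂ (_ , refl)) (inj₂ (_ , refl)) = mk⇔ (cong suc) suc-injective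
  ≡-matched (inj₁ (x<g , refl)) (inj₂ (hx′ , refl)) =
    mk⇔ (λ { refl → ⊥-elim (low≮high x<g hx′) }) (λ { refl → ⊥-elim (low≮high x<g (m≤n⇒m≤1+n hx′)) })
  ≡-matched (inj₂ (hx , refl)) (inj₁ (x′<g , refl)) =
    mk⇔ (λ { refl → ⊥-elim (low≮high x′<g hx) }) (λ { refl → ⊥-elim (low≮high x′<g (m≤n⇒m≤1+n hx)) })


record Narrowing (n g L w x y : ℕ) : Set where
  field
    {g′ L′} : ℕ
    gap′    : Gap n g′ L′
    w≤L′    : w ≤ L′
    matched : Matched g′ L′ x y
    refines : ∀ {a b} → Matched g L a b → Matched g′ L′ a b

∃-diff : ∀ {m n} → m ≤ n → ∃ λ k → m + k ≡ n
∃-diff {n = n} z≤n = n , refl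
∃-diff (s≤s m≤n) with ∃-diff m≤n
... | k , m+k≡n = k , cong suc m+k≡n

room-below : ∀ g L x w → g + L ≤ x + w → suc (w + w) ≤ L → suc (g + w) ≤ x
room-below g L x w g+L≤x+w 2w<L = +-cancelʳ-≤ w (suc (g + w)) x
  (≤-trans (≤-reflexive rearranged) (≤-trans (+-monoʳ-≤ g 2w<L) g+L≤x+w))
  where
    rearranged : suc (g + w) + w ≡ g + suc (w + w)
    rearranged = trans (cong suc (+-assoc g w w)) (sym (+-suc g (w + w)))

-- A pebble in a gap of width ≥ 2w+1 splits it into two parts, one of width ≥ w:
-- if the part above the pebble is wide enough the pebble stays put, otherwise
-- it is matched with its shift and the part below becomes the new gap.
module _ {n g L w : ℕ} (gap : Gap n g L) (2w<L : suc (w + w) ≤ L) (2≤w : 2 ≤ w) where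
  open Gap gap

  keep-gap : ∀ {x y} → Matched g L x y → Narrowing n g L w x y
  keep-gap m = record { gap′ = gap ; w≤L′ = ≤-trans (m≤n+m w w) (≤-trans (n≤1+n _) 2w<L)
                      ; matched = m ; refines = λ m′ → m′ }

  gap-above : ∀ x → g ≤ x → suc x + w ≤ g + L → Narrowing n g L w x x
  gap-above x g≤x x+1+w≤g+L with ∃-diff (m+n≤o⇒m≤o (suc x) x+1+w≤g+L)
  ... | L′ , top≡ = record
    { gap′ = record { 3≤g = ≤-trans 3≤g (m≤n⇒m≤1+n g≤x)
                    ; g+L+2≤n = subst (λ t → 2 + t ≤ n) (sym top≡) g+L+2≤n
                    ; 2≤L = ≤-trans 2≤w w≤L′ }
    ; w≤L′ = w≤L′ ; matched = inj₁ (≤-refl , refl) ; refines = refines }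
    where
      w≤L′ : w ≤ L′
      w≤L′ = +-cancelˡ-≤ (suc x) w L′ (subst (suc x + w ≤_) (sym top≡) x+1+w≤g+L)
      refines : ∀ {a b} → Matched g L a b → Matched (suc x) L′ a b
      refines (inj₁ (a<g , b≡)) = inj₁ (≤-trans a<g (m≤n⇒m≤1+n g≤x) , b≡)
      refines {a} (inj₂ (ha , b≡)) = inj₂ (subst (_≤ a) (sym top≡) ha , b≡)

  gap-below : ∀ x → suc (g + w) ≤ suc x → x ≤ g + L → Narrowing n g L w x (suc x)
  gap-below x g+w≤x x≤g+L with ∃-diff (m+n≤o⇒m≤o g (≤-pred g+w≤x))
  ... | L′ , x≡ = record
    { gap′ = record { 3≤g = 3≤g
                    ; g+L+2≤n = ≤-trans (+-monoʳ-≤ 2 (≤-reflexive x≡)) (≤-trans (+-monoʳ-≤ 2 x≤g+L) g+L+2≤n)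
                    ; 2≤L = ≤-trans 2≤w w≤L′ }
    ; w≤L′ = w≤L′ ; matched = inj₂ (≤-reflexive x≡ , refl) ; refines = refines }
    where
      w≤L′ : w ≤ L′
      w≤L′ = +-cancelˡ-≤ g w L′ (subst (g + w ≤_) (sym x≡) (≤-pred g+w≤x))
      refines : ∀ {a b} → Matched g L a b → Matched g L′ a b
      refines (inj₁ m) = inj₁ m
      refines (inj₂ (ha , b≡)) = inj₂ (≤-trans (≤-reflexive x≡) (≤-trans x≤g+L ha) , b≡)

  forth : ∀ x → x < n → ∃ λ y → y < suc n × Narrowing n g L w x y
  forth x x<n with x <? g
  ... | yes x<g = x , m≤n⇒m≤1+n x<n , keep-gap (inj₁ (x<g , refl))
  ... | no x≮g with g + L ≤? x
  ... | yes g+L≤x = suc x , s≤s x<n , keep-gap (inj₂ (g+L≤x , refl))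
  ... | no g+L≰x with suc x + w ≤? g + L
  ... | yes fits = x , m≤n⇒m≤1+n x<n , gap-above x (≮⇒≥ x≮g) fits
  ... | no ¬fits = suc x , s≤s x<n ,
    gap-below x (m≤n⇒m≤1+n (room-below g L x w (≤-pred (≰⇒> ¬fits)) 2w<L)) (<⇒≤ (≰⇒> g+L≰x))

  back : ∀ y → y < suc n → ∃ λ x → x < n × Narrowing n g L w x y
  back y y<n+1 with y <? g
  ... | yes y<g = y , ≤-trans y<g (≤-trans (m≤m+n g L) (≤-trans (m≤n+m _ 2) g+L+2≤n)) , keep-gap (inj₁ (y<g , refl))
  back zero _ | no 0≮g = ⊥-elim (0≮g (≤-trans (s≤s z≤n) 3≤g))
  back (suc x) x+1<n+1 | no x+1≮g with g + L ≤? x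
  ... | yes g+L≤x = x , ≤-pred x+1<n+1 , keep-gap (inj₂ (g+L≤x , refl))
  ... | no g+L≰x with suc (suc x) + w ≤? g + L
  ... | yes fits = suc x , ≤-trans (s≤s (≰⇒> g+L≰x)) (≤-trans (n≤1+n _) g+L+2≤n) , gap-above (suc x) (≮⇒≥ x+1≮g) fits
  ... | no ¬fits = x , ≤-pred x+1<n+1 ,
    gap-below x (room-below g L (suc x) w (≤-pred (≰⇒> ¬fits)) 2w<L) (<⇒≤ (≰⇒> g+L≰x))

depth : ∀ {k} → Formula k → ℕ
depth (rel _ _ _) = 0
depth (eq _ _) = 0
depth ⊤f = 0
depth ⊥f = 0
depth (¬f φ) = depth φ
depth (φ ∧f ψ) = depth φ ⊔ depth ψ
depth (φ ∨f ψ) = depth φ ⊔ depth ψ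
depth (φ ⇒f ψ) = depth φ ⊔ depth ψ
depth (∀f φ) = suc (depth φ)
depth (∃f φ) = suc (depth φ)

width : ℕ → ℕ
width zero = 2
width (suc d) = suc (width d + width d)

2≤width : ∀ d → 2 ≤ width d
2≤width zero = ≤-refl
2≤width (suc d) = m≤n⇒m≤1+n (≤-trans (2≤width d) (m≤m+n _ _))

width-mono : ∀ {d d′} → d ≤ d′ → width d ≤ width d′
width-mono {zero} {zero} _ = ≤-refl
width-mono {zero} {suc d′} _ = m≤n⇒m≤1+n (≤-trans (width-mono {zero} {d′} z≤n) (m≤m+n _ _))
width-mono {suc d} {suc d′} (s≤s d≤d′) = s≤s (+-mono-≤ (width-mono d≤d′) (width-mono d≤d′))

edge-matched : ∀ {n g L} → Gap n g L → ∀ {a b : Fin n} {c d : Fin (suc n)} →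
  Matched g L (toℕ a) (toℕ c) → Matched g L (toℕ b) (toℕ d) → edge n a b ≡ edge (suc n) c d
edge-matched gap ma mb = ⌊⌋-cong (Edge? _ _ _) (Edge? _ _ _) (Edge-matched gap ma mb)

==-matched : ∀ {n g L} → Gap n g L → ∀ {a b : Fin n} {c d : Fin (suc n)} →
  Matched g L (toℕ a) (toℕ c) → Matched g L (toℕ b) (toℕ d) → (a == b) ≡ (c == d)
==-matched gap ma mb = ⌊⌋-cong (_ F.≟ _) (_ F.≟ _)
  (mk⇔ (λ a≡b → toℕ-injective (to (cong toℕ a≡b))) (λ c≡d → toℕ-injective (from (cong toℕ c≡d))))
  where open Equivalence (≡-matched gap ma mb)

MatchedEnv : ∀ {k n} → ℕ → ℕ → (Fin k → Fin n) → (Fin k → Fin (suc n)) → Set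
MatchedEnv g L ρ₁ ρ₂ = ∀ i → Matched g L (toℕ (ρ₁ i)) (toℕ (ρ₂ i))

left-width : ∀ {d e L} → width (d ⊔ e) ≤ L → width d ≤ L
left-width w = ≤-trans (width-mono (m≤m⊔n _ _)) w

right-width : ∀ {d e L} → width (d ⊔ e) ≤ L → width e ≤ L
right-width w = ≤-trans (width-mono (m≤n⊔m _ _)) w

extend-matched : ∀ {k n g L w x y} {ρ₁ : Fin k → Fin n} {ρ₂ : Fin k → Fin (suc n)} →
  (N : Narrowing n g L w x y) → MatchedEnv g L ρ₁ ρ₂ → ∀ {a c} → toℕ a ≡ x → toℕ c ≡ y →
  MatchedEnv (Narrowing.g′ N) (Narrowing.L′ N) (extend ρ₁ a) (extend ρ₂ c)
extend-matched N m refl refl zero = Narrowing.matched N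
extend-matched N m _ _ (suc i) = Narrowing.refines N (m i)

-- Ehrenfeucht–Fraïssé: a gap of width (width d) between the two matched
-- assignments survives d rounds of the back-and-forth game.
back-and-forth : ∀ {k} (φ : Formula (suc k)) {n g L} {ρ₁ : Fin k → Fin n} {ρ₂ : Fin k → Fin (suc n)} →
  Gap n g L → width (suc (depth φ)) ≤ L → MatchedEnv g L ρ₁ ρ₂ →
  BackAndForth (λ a → eval (Dn n) φ (extend ρ₁ a)) (λ c → eval (Dn (suc n)) φ (extend ρ₂ c))

eval-matched : ∀ {k} (φ : Formula k) {n g L} {ρ₁ : Fin k → Fin n} {ρ₂ : Fin k → Fin (suc n)} →
  Gap n g L → width (depth φ) ≤ L → MatchedEnv g L ρ₁ ρ₂ → eval (Dn n) φ ρ₁ ≡ eval (Dn (suc n)) φ ρ₂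
eval-matched (rel i j l) gap _ m
  rewrite ==-matched gap (m i) (m l) | ==-matched gap (m j) (m i) | ==-matched gap (m j) (m l)
        | edge-matched gap (m i) (m l) = refl
eval-matched (eq i j) gap _ m = ==-matched gap (m i) (m j)
eval-matched ⊤f _ _ _ = refl
eval-matched ⊥f _ _ _ = refl
eval-matched (¬f φ) gap w m = cong not (eval-matched φ gap w m)
eval-matched (φ ∧f ψ) gap w m = cong₂ _∧_ (eval-matched φ gap (left-width w) m) (eval-matched ψ gap (right-width w) m)
eval-matched (φ ∨f ψ) gap w m = cong₂ _∨_ (eval-matched φ gap (left-width w) m) (eval-matched ψ gap (right-width w) m)
eval-matched (φ ⇒f ψ) gap w m =
  cong₂ (λ a b → not a ∨ b) (eval-matched φ gap (left-width w) m) (eval-matched ψ gap (right-width w) m)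
eval-matched (∀f φ) gap w m = all-allFin-cong (back-and-forth φ gap w m)
eval-matched (∃f φ) gap w m = any-allFin-cong (back-and-forth φ gap w m)

back-and-forth φ {n} {ρ₁ = ρ₁} {ρ₂} gap w m = forth′ , back′
  where
    forth′ : Covers (λ c → eval (Dn (suc n)) φ (extend ρ₂ c)) (λ a → eval (Dn n) φ (extend ρ₁ a))
    forth′ a with forth gap w (2≤width (depth φ)) (toℕ a) (toℕ<n a)
    ... | y , y<n+1 , N = fromℕ< y<n+1 ,
      eval-matched φ (Narrowing.gap′ N) (Narrowing.w≤L′ N) (extend-matched N m refl (toℕ-fromℕ< y<n+1))
    back′ : Covers (λ a → eval (Dn n) φ (extend ρ₁ a)) (λ c → eval (Dn (suc n)) φ (extend ρ₂ c))
    back′ c with back gap w (2≤width (depth φ)) (toℕ c) (toℕ<n c)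
    ... | x , x<n , N = fromℕ< x<n ,
      sym (eval-matched φ (Narrowing.gap′ N) (Narrowing.w≤L′ N) (extend-matched N m (toℕ-fromℕ< x<n) refl))

eval-Dn-suc : (σ : Sentence) → ∀ {n} → 5 + width (depth σ) ≤ n → eval (Dn n) σ noVars ≡ eval (Dn (suc n)) σ noVars
eval-Dn-suc σ n-large = eval-matched σ gap ≤-refl (λ ())
  where
    gap : Gap _ 3 (width (depth σ))
    gap = record { 3≤g = ≤-refl ; g+L+2≤n = n-large ; 2≤L = 2≤width (depth σ) }

-- Odd n: Dn n is not a W-structure

∃-other : ∀ a b → ∃ λ z → z ≤ 2 × z ≢ a × z ≢ b
∃-other a b with 0 ≟ a | 0 ≟ b
... | no 0≢a | no 0≢b = 0 , z≤n , 0≢a , 0≢b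
... | yes refl | _ with 1 ≟ b
...   | no 1≢b = 1 , s≤s z≤n , (λ ()) , 1≢b
...   | yes refl = 2 , ≤-refl , (λ ()) , (λ ())
∃-other a b | no _ | yes refl with 1 ≟ a
...   | no 1≢a = 1 , s≤s z≤n , 1≢a , (λ ())
...   | yes refl = 2 , ≤-refl , (λ ()) , (λ ())

∃-other-Fin : ∀ {n} → 3 ≤ n → (x y : Fin n) → ∃ λ w → w ≢ x × w ≢ y
∃-other-Fin 3≤n x y with ∃-other (toℕ x) (toℕ y)
... | z , z≤2 , z≢x , z≢y = fromℕ< z<n , ≢-via-toℕ z≢x , ≢-via-toℕ z≢y
  where
    z<n : z < _
    z<n = ≤-trans (s≤s z≤2) 3≤n
    ≢-via-toℕ : ∀ {v} → z ≢ toℕ v → fromℕ< z<n ≢ v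
    ≢-via-toℕ z≢v refl = z≢v (sym (toℕ-fromℕ< z<n))

-- Dn n determines the graph it could be the W-structure of: a non-edge puts a
-- third vertex into T(x,y), an edge keeps T(x,y) = {x,y}.
realizer-of-Dn : ∀ {n} → 4 ≤ n → (G : Graph n) → RealizesW G (Dn n) → ∀ x y → adj G x y ≡ edge n x y
realizer-of-Dn {n} 4≤n G realizes x y = ⇔→≡ {z = true} (mk⇔ G⇒H H⇒G)
  where
    open TollWalks G

    G⇒H : x ~ y → edge n x y ≡ true
    G⇒H x~y with edge n x y in e
    ... | true = refl
    ... | false with ∃-other-Fin (≤-trans (n≤1+n 3) 4≤n) x y
    ... | w , w≢x , w≢y with proj₁ (realizes x w y) (D-nonadjacent (edge n) w (λ { refl → ~-irrefl x~y }) e)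
    ... | inj₁ (refl , _) = ⊥-elim (~-irrefl x~y)
    ... | inj₂ (_ , W , tw , w∈W) with tollWalk-adjacent x~y tw w∈W
    ... | inj₁ w≡x = ⊥-elim (w≢x w≡x)
    ... | inj₂ w≡y = ⊥-elim (w≢y w≡y)

    H⇒G : edge n x y ≡ true → x ~ y
    H⇒G e with x F.≟ y
    ... | yes refl = ⊥-elim (Edge-irrefl 4≤n (edge⁻ e))
    ... | no x≢y with proj₁ (realizes x x y) (trans (D-adjacent (edge n) x x≢y e) (cong (_∨ (x == y)) (==-refl x)))
    ... | inj₁ (x≡y , _) = ⊥-elim (x≢y x≡y)
    ... | inj₂ (_ , W , tw@(a , _ , (_ , refl) , _ , (x~a , _) , _) , _)
      with ∨-true⁻ (trans (sym (D-adjacent (edge n) a x≢y e)) (proj₂ (realizes x a y) (inj₂ (x≢y , W , tw , there (here refl)))))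
    ... | inj₁ a≡x = ⊥-elim (~-irrefl (subst (x ~_) (==⁻ a≡x) x~a))
    ... | inj₂ a≡y = subst (x ~_) (==⁻ a≡y) x~a

isEven : ℕ → Bool
isEven zero = true
isEven (suc zero) = false
isEven (suc (suc k)) = isEven k

isEven-suc : ∀ k → isEven (suc k) ≡ not (isEven k)
isEven-suc zero = refl
isEven-suc (suc zero) = refl
isEven-suc (suc (suc k)) = isEven-suc k

isEven-double : ∀ k → isEven (k + k) ≡ true
isEven-double zero = refl
isEven-double (suc k) rewrite +-suc k k = isEven-double k

isEven-double+1 : ∀ k → isEven (suc (k + k)) ≡ false
isEven-double+1 k = trans (isEven-suc (k + k)) (cong not (isEven-double k))

-- For n = 2m+1 the toll walk from 0 to 3 must leave 0 through 1 or 2 and never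
-- come back to the other one; {0} ∪ odd vertices and the even vertices are then
-- each closed, so the walk cannot pass through both 3 and 4.
module OddCase (m : ℕ) (2≤m : 2 ≤ m) where

  n : ℕ
  n = suc (m + m)

  5≤n : 5 ≤ n
  5≤n = s≤s (+-mono-≤ 2≤m 2≤m)

  2m+1≡n : ∀ {x} → 1 + x ≡ n → x ≡ m + m
  2m+1≡n = suc-injective

  Edge-from-0 : ∀ {j} → Edge n 0 j → j ≡ 1 ⊎ j ≡ 2
  Edge-from-0 (inj₁ (inj₁ refl)) = inj₂ refl
  Edge-from-0 (inj₁ (inj₂ (inj₂ (inj₁ (_ , refl))))) = inj₁ refl
  Edge-from-0 (inj₂ (inj₁ (inj₁ (() , _))))
  Edge-from-0 (inj₂ (inj₁ (inj₂ (() , _))))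
  Edge-from-0 (inj₂ (inj₂ (inj₁ (refl , 2≡n)))) = ⊥-elim (<-irrefl 2≡n (≤-trans (s≤s (s≤s (s≤s z≤n))) 5≤n))
  Edge-from-0 (inj₂ (inj₂ (inj₂ (refl , 1≡n)))) = ⊥-elim (<-irrefl 1≡n (≤-trans (s≤s (s≤s z≤n)) 5≤n))

  Even : ℕ → Set
  Even x = isEven x ≡ true

  Even-closed : ∀ {x y} → Even x → Edge n x y → Even y ⊎ (x ≡ 0 × y ≡ 1)
  Even-closed ex (inj₁ (inj₁ refl)) = inj₁ ex
  Even-closed ex (inj₁ (inj₂ (inj₁ refl))) = inj₁ ex
  Even-closed ex (inj₁ (inj₂ (inj₂ (inj₁ e)))) = inj₂ e
  Even-closed () (inj₁ (inj₂ (inj₂ (inj₂ (refl , refl)))))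
  Even-closed () (inj₂ (inj₁ (inj₁ (refl , _))))
  Even-closed _ (inj₂ (inj₁ (inj₂ (refl , e)))) = inj₁ (subst Even (sym (2m+1≡n e)) (isEven-double m))
  Even-closed {x} ex (inj₂ (inj₂ (inj₁ (refl , e)))) =
    ⊥-elim (true≢false (trans (sym (subst Even (sym (2m+1≡n e)) (isEven-double m))) (trans (isEven-suc x) (cong not ex))))
  Even-closed _ (inj₂ (inj₂ (inj₂ (refl , _)))) = inj₁ refl

  OddOr0 : ℕ → Set
  OddOr0 x = x ≡ 0 ⊎ isEven x ≡ false

  OddOr0-closed : ∀ {x y} → OddOr0 x → Edge n x y → OddOr0 y ⊎ (x ≡ 0 × y ≡ 2)
  OddOr0-closed (inj₁ refl) e with Edge-from-0 e
  ... | inj₁ refl = inj₁ (inj₂ refl)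
  ... | inj₂ refl = inj₂ (refl , refl)
  OddOr0-closed (inj₂ ox) (inj₁ (inj₁ refl)) = inj₁ (inj₂ ox)
  OddOr0-closed {y = zero} (inj₂ _) (inj₁ (inj₂ (inj₁ refl))) = inj₁ (inj₁ refl)
  OddOr0-closed {y = suc _} (inj₂ ox) (inj₁ (inj₂ (inj₁ refl))) = inj₁ (inj₂ ox)
  OddOr0-closed (inj₂ ()) (inj₁ (inj₂ (inj₂ (inj₁ (refl , refl)))))
  OddOr0-closed (inj₂ _) (inj₁ (inj₂ (inj₂ (inj₂ (refl , refl))))) = inj₁ (inj₁ refl)
  OddOr0-closed {y = y} (inj₂ _) (inj₂ (inj₁ (inj₁ (refl , e)))) =
    inj₁ (inj₂ (trans (sym (not-involutive (isEven y))) (cong not (trans (sym (isEven-suc y)) (subst Even (sym (2m+1≡n e)) (isEven-double m))))))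
  OddOr0-closed (inj₂ ()) (inj₂ (inj₁ (inj₂ (refl , _))))
  OddOr0-closed (inj₂ _) (inj₂ (inj₂ (inj₁ (refl , _)))) = inj₁ (inj₂ refl)
  OddOr0-closed (inj₂ ox) (inj₂ (inj₂ (inj₂ (refl , e)))) =
    ⊥-elim (true≢false (trans (sym (subst Even (sym (2m+1≡n e)) (isEven-double m))) ox))

  0<n : 0 < n
  0<n = s≤s z≤n

  3<n : 3 < n
  3<n = ≤-trans (n≤1+n 4) 5≤n

  v₀ v₃ v₄ : Fin n
  v₀ = fromℕ< 0<n
  v₃ = fromℕ< 3<n
  v₄ = fromℕ< 5≤n

  toℕ-v₀ : toℕ v₀ ≡ 0
  toℕ-v₀ = toℕ-fromℕ< 0<n

  toℕ-v₃ : toℕ v₃ ≡ 3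
  toℕ-v₃ = toℕ-fromℕ< 3<n

  toℕ-v₄ : toℕ v₄ ≡ 4
  toℕ-v₄ = toℕ-fromℕ< 5≤n

  ¬Edge-0-3 : ¬ Edge n 0 3
  ¬Edge-0-3 (inj₁ (inj₁ ()))
  ¬Edge-0-3 (inj₁ (inj₂ (inj₁ ())))
  ¬Edge-0-3 (inj₁ (inj₂ (inj₂ (inj₁ (_ , ())))))
  ¬Edge-0-3 (inj₁ (inj₂ (inj₂ (inj₂ (() , _)))))
  ¬Edge-0-3 (inj₂ (inj₁ (inj₁ (() , _))))
  ¬Edge-0-3 (inj₂ (inj₁ (inj₂ (() , _))))
  ¬Edge-0-3 (inj₂ (inj₂ (inj₁ (() , _))))
  ¬Edge-0-3 (inj₂ (inj₂ (inj₂ (() , _))))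

  v₀≢v₃ : v₀ ≢ v₃
  v₀≢v₃ e with trans (sym toℕ-v₀) (trans (cong toℕ e) toℕ-v₃)
  ... | ()

  1≢2 : 1 ≢ 2
  1≢2 ()

  module _ (G : Graph n) (realizes : RealizesW G (Dn n)) where
    open TollWalks G

    edge-of : ∀ {x y} → x ~ y → Edge n (toℕ x) (toℕ y)
    edge-of {x} {y} x~y = edge⁻ (trans (sym (realizer-of-Dn (≤-trans (n≤1+n 4) 5≤n) G realizes x y)) x~y)

    confined : ∀ {v W} (tw : TollWalk G v₀ v W) (P : ℕ → Set) (c : ℕ) → P 0 → c ≢ toℕ (proj₁ tw) →
      (∀ {x y} → P x → Edge n x y → P y ⊎ (x ≡ 0 × y ≡ c)) → ∀ {y} → y ∈ W → P (toℕ y)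
    confined tw@(a , _ , _ , _ , _ , _ , only-a , _) P c p0 c≢a closed =
      tollWalk-invariant tw (λ x → P (toℕ x)) (subst P (sym toℕ-v₀) p0) step
      where
        step : ∀ {x y} → P (toℕ x) → x ~ y → y ∈ _ → P (toℕ y)
        step {x} {y} px x~y y∈W with closed px (edge-of x~y)
        ... | inj₁ py = py
        ... | inj₂ (x≡0 , y≡c) with toℕ-injective (trans x≡0 (sym toℕ-v₀))
        ... | refl = ⊥-elim (c≢a (trans (sym y≡c) (cong toℕ (only-a y y∈W x~y))))

    4∉T[0,3] : ¬ InT G v₀ v₃ v₄
    4∉T[0,3] (inj₁ (v₀≡v₃ , _)) = v₀≢v₃ v₀≡v₃
    4∉T[0,3] (inj₂ (_ , W , tw@(a , _ , (_ , refl) , _ , (0~a , _) , _) , 4∈W))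
      with Edge-from-0 (subst (λ i → Edge n i (toℕ a)) toℕ-v₀ (edge-of 0~a))
    ... | inj₂ a≡2 = true≢false (sym (subst (λ i → isEven i ≡ true) toℕ-v₃ 3-even))
      where 3-even : Even (toℕ v₃)
            3-even = confined tw Even 1 refl (λ 1≡a → 1≢2 (trans 1≡a a≡2)) Even-closed (last∈tollWalk tw)
    ... | inj₁ a≡1 = ¬OddOr0-4 (subst OddOr0 toℕ-v₄ (confined tw OddOr0 2 (inj₁ refl) (λ 2≡a → 1≢2 (trans (sym a≡1) (sym 2≡a))) OddOr0-closed 4∈W))
      where ¬OddOr0-4 : ¬ OddOr0 4
            ¬OddOr0-4 (inj₁ ())
            ¬OddOr0-4 (inj₂ ())

  Dn-odd-not-W : ¬ IsWStructure (Dn n)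
  Dn-odd-not-W (G , realizes) = 4∉T[0,3] G realizes (proj₁ (realizes v₀ v₄ v₃) (D-nonadjacent (edge n) v₄ v₀≢v₃ (non-edge⁺ ¬edge)))
    where
      ¬edge : ¬ Edge n (toℕ v₀) (toℕ v₃)
      ¬edge = subst₂ (λ i j → ¬ Edge n i j) (sym toℕ-v₀) (sym toℕ-v₃) ¬Edge-0-3

-- Even n: Dn n is the W-structure of H n

-- H (2m) in cycle coordinates (see EvenCase.toH): the rim 1 … N, N = 2m − 1,
-- is a cycle and the hub 0 is joined to 1 and m.
module CycleWithHub (m₁ : ℕ) (3≤m₁ : 3 ≤ m₁) where
  m : ℕ
  m = suc m₁
  N : ℕ
  N = m₁ + m

  RimEdge : ℕ → ℕ → Set
  RimEdge p q = (1 ≤ p × suc p ≡ q × q ≤ N) ⊎ (p ≡ N × q ≡ 1)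

  Spoke : ℕ → ℕ → Set
  Spoke p q = p ≡ 0 × (q ≡ 1 ⊎ q ≡ m)

  Link : ℕ → ℕ → Set
  Link p q = RimEdge p q ⊎ RimEdge q p ⊎ Spoke p q ⊎ Spoke q p

  Link-sym : ∀ {p q} → Link p q → Link q p
  Link-sym (inj₁ c) = inj₂ (inj₁ c)
  Link-sym (inj₂ (inj₁ c)) = inj₁ c
  Link-sym (inj₂ (inj₂ (inj₁ h))) = inj₂ (inj₂ (inj₂ h))
  Link-sym (inj₂ (inj₂ (inj₂ h))) = inj₂ (inj₂ (inj₁ h))

  m≤N : m ≤ N
  m≤N = m≤n+m m m₁

  3≤m : 3 ≤ m
  3≤m = m≤n⇒m≤1+n 3≤m₁

  link-1-N : Link 1 N
  link-1-N = inj₂ (inj₁ (inj₂ (refl , refl)))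

  link-N-1 : Link N 1
  link-N-1 = inj₁ (inj₂ (refl , refl))

  link-0-1 : Link 0 1
  link-0-1 = inj₂ (inj₂ (inj₁ (refl , inj₁ refl)))

  link-1-0 : Link 1 0
  link-1-0 = inj₂ (inj₂ (inj₂ (refl , inj₁ refl)))

  link-0-m : Link 0 m
  link-0-m = inj₂ (inj₂ (inj₁ (refl , inj₂ refl)))

  link-m-0 : Link m 0
  link-m-0 = inj₂ (inj₂ (inj₂ (refl , inj₂ refl)))

  link-up : ∀ {p} → 1 ≤ p → suc p ≤ N → Link p (suc p)
  link-up p1 pN = inj₁ (inj₁ (p1 , refl , pN))

  link-down : ∀ {p} → 1 ≤ p → suc p ≤ N → Link (suc p) p
  link-down p1 pN = inj₂ (inj₁ (inj₁ (p1 , refl , pN)))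

  m<N : m < N
  m<N = +-monoˡ-≤ m (≤-trans (s≤s z≤n) 3≤m₁)

  data LinkView (p k : ℕ) : Set where
    up : 1 ≤ p → k ≡ suc p → LinkView p k
    down : 1 ≤ k → suc k ≡ p → LinkView p k
    wrapN : p ≡ N → k ≡ 1 → LinkView p k
    wrap1 : p ≡ 1 → k ≡ N → LinkView p k
    from-hub : p ≡ 0 → (k ≡ 1 ⊎ k ≡ m) → LinkView p k
    to-hub : k ≡ 0 → (p ≡ 1 ⊎ p ≡ m) → LinkView p k

  link-view : ∀ {p k} → Link p k → LinkView p k
  link-view (inj₁ (inj₁ (l , e , _))) = up l (sym e)
  link-view (inj₁ (inj₂ (e , f))) = wrapN e f
  link-view (inj₂ (inj₁ (inj₁ (l , e , _)))) = down l e
  link-view (inj₂ (inj₁ (inj₂ (e , f)))) = wrap1 f e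
  link-view (inj₂ (inj₂ (inj₁ (e , f)))) = from-hub e f
  link-view (inj₂ (inj₂ (inj₂ (e , f)))) = to-hub e f

  Adm : ℕ → ℕ → ℕ → ℕ → ℕ → Set
  Adm u v a b k = (Link u k → k ≡ a) × (Link v k → k ≡ b)

  StepIn : (ℕ → Set) → ℕ → ℕ → Set
  StepIn A p q = Link p q × A p × A q × p ≤ N × q ≤ N

  StepIn-sym : ∀ {A p q} → StepIn A p q → StepIn A q p
  StepIn-sym (a , x , y , p , q) = Link-sym a , y , x , q , p

  reverse-path : ∀ {A p q} → Star (StepIn A) p q → Star (StepIn A) q p
  reverse-path = Star.reverse StepIn-sym

  ascend : ∀ {A} i j → 1 ≤ i → i ≤ j → j ≤ N → (∀ k → i ≤ k → k ≤ j → A k) → Star (StepIn A) i j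
  ascend i zero i1 ij jN adm = ⊥-elim (<-irrefl refl (≤-trans i1 ij))
  ascend i (suc j) i1 ij jN adm with i ≟ suc j
  ... | yes refl = ε
  ... | no ne = ascend i j i1 ij′ (≤-trans (n≤1+n j) jN) (λ k a b → adm k a (≤-trans b (n≤1+n j)))
       ◅◅ ((link-up (≤-trans i1 ij′) jN , adm j ij′ (n≤1+n j) , adm (suc j) ij ≤-refl , ≤-trans (n≤1+n j) jN , jN) ◅ ε)
    where ij′ : i ≤ j
          ij′ = ≤-pred (≤∧≢⇒< ij ne)

  interval-path : ∀ {A} lo hi → 1 ≤ lo → hi ≤ N → (∀ k → lo ≤ k → k ≤ hi → A k) →
    ∀ i j → lo ≤ i → i ≤ hi → lo ≤ j → j ≤ hi → Star (StepIn A) i j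
  interval-path lo hi l1 hN adm i j li ih lj jh with i ≤? j
  ... | yes ij = ascend i j (≤-trans l1 li) ij (≤-trans jh hN) (λ k a b → adm k (≤-trans li a) (≤-trans b jh))
  ... | no ij = reverse-path (ascend j i (≤-trans l1 lj) (<⇒≤ (≰⇒> ij)) (≤-trans ih hN) (λ k a b → adm k (≤-trans lj a) (≤-trans b ih)))

  absurd-< : ∀ {x y} {A : Set} → x < y → y ≤ x → A
  absurd-< lt le = ⊥-elim (<⇒≱ lt le)

  1≤N : 1 ≤ N
  1≤N = ≤-trans (s≤s z≤n) m≤N

  rim-link-elim : ∀ {p k c} → 1 ≤ p → 1 ≤ k → (k ≡ suc p → k ≡ c) → (suc k ≡ p → k ≡ c) →
    (p ≡ N → k ≡ 1 → k ≡ c) → (p ≡ 1 → k ≡ N → k ≡ c) → Link p k → k ≡ c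
  rim-link-elim p1 k1 f1 f2 f3 f4 a with link-view a
  ... | up _ e = f1 e
  ... | down _ e = f2 e
  ... | wrapN e f = f3 e f
  ... | wrap1 e f = f4 e f
  ... | from-hub refl _ = absurd-< p1 ≤-refl
  ... | to-hub refl _ = absurd-< k1 ≤-refl

  hub-link-elim : ∀ {k c} → 1 ≤ k → (k ≡ 1 → k ≡ c) → (k ≡ m → k ≡ c) → Link 0 k → k ≡ c
  hub-link-elim k1 f1 f2 a with link-view a
  ... | up () _
  ... | down _ ()
  ... | wrapN e _ = absurd-< 1≤N (≤-reflexive (sym e))
  ... | wrap1 () _
  ... | from-hub _ (inj₁ e) = f1 e
  ... | from-hub _ (inj₂ e) = f2 e
  ... | to-hub refl _ = absurd-< k1 ≤-refl

  link-hub-elim : ∀ {p c} → (p ≡ 1 → 0 ≡ c) → (p ≡ m → 0 ≡ c) → Link p 0 → 0 ≡ c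
  link-hub-elim f1 f2 a with link-view a
  ... | up _ ()
  ... | down () _
  ... | wrapN _ ()
  ... | wrap1 _ e = absurd-< 1≤N (≤-reflexive (sym e))
  ... | from-hub refl (inj₁ ())
  ... | from-hub refl (inj₂ ())
  ... | to-hub _ (inj₁ e) = f1 e
  ... | to-hub _ (inj₂ e) = f2 e

  -- Neighbours a of u and b of v joined by an admissible path through y; then
  -- u a … y … b v is a toll walk (InT-of-Through).
  Through : ℕ → ℕ → ℕ → Set
  Through u v y = Σ ℕ λ a → Σ ℕ λ b → Link u a × Link v b × Adm u v a b a ×
    Star (StepIn (Adm u v a b)) a y × Star (StepIn (Adm u v a b)) y b

  through-interval : ∀ {u v} a b y lo hi → Link u a → Link v b → 1 ≤ lo → hi ≤ N →
    (∀ k → lo ≤ k → k ≤ hi → Adm u v a b k) →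
    lo ≤ a → a ≤ hi → lo ≤ y → y ≤ hi → lo ≤ b → b ≤ hi → Through u v y
  through-interval a b y lo hi ua vb l1 hN adm la ah ly yh lb bh =
    a , b , ua , vb , adm a la ah , interval-path lo hi l1 hN adm a y la ah ly yh , interval-path lo hi l1 hN adm y b ly yh lb bh

  absurd-≡< : ∀ {k x} → k ≡ x → k < x → ∀ {A : Set} → A
  absurd-≡< refl lt = ⊥-elim (<-irrefl refl lt)

  absurd-≡> : ∀ {k x} → k ≡ x → x < k → ∀ {A : Set} → A
  absurd-≡> refl lt = ⊥-elim (<-irrefl refl lt)

  hub-low-inside : ∀ v′ y → 1 ≤ v′ → suc v′ < m → 1 ≤ y → y ≤ v′ → Through 0 (suc v′) y
  hub-low-inside v′ y v1 vm y1 yv = through-interval 1 v′ y 1 v′ link-0-1 (link-down v1 vN)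
      ≤-refl vN′ adm ≤-refl v1 y1 yv v1 ≤-refl
    where
      vN : suc v′ ≤ N
      vN = ≤-trans (<⇒≤ vm) m≤N
      vN′ : v′ ≤ N
      vN′ = ≤-trans (n≤1+n v′) vN
      adm : ∀ k → 1 ≤ k → k ≤ v′ → Adm 0 (suc v′) 1 v′ k
      adm k k1 kv = hub-link-elim k1 (λ e → e) (λ e → absurd-≡< e (≤-trans (s≤s kv) (<⇒≤ vm))) ,
                   rim-link-elim (s≤s z≤n) k1 (λ e → absurd-≡< e (s≤s (≤-trans kv (n≤1+n v′)))) suc-injective
                        (λ e _ → absurd-≡< e (≤-trans vm m≤N)) (λ e _ → absurd-< v1 (≤-reflexive (suc-injective e)))

  hub-low-outside : ∀ v′ y → 1 ≤ v′ → suc v′ < m → suc (suc v′) ≤ y → y ≤ N → Through 0 (suc v′) y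
  hub-low-outside v′ y v1 vm yl yN = through-interval m (suc (suc v′)) y (suc (suc v′)) N link-0-m
      (link-up (s≤s z≤n) (≤-trans vm m≤N)) (s≤s z≤n) ≤-refl adm vm m≤N yl yN ≤-refl (≤-trans vm m≤N)
    where
      adm : ∀ k → suc (suc v′) ≤ k → k ≤ N → Adm 0 (suc v′) m (suc (suc v′)) k
      adm k kl kN = hub-link-elim (≤-trans (s≤s z≤n) kl) (λ e → absurd-≡> e (≤-trans (s≤s (s≤s z≤n)) (≤-trans (s≤s (s≤s v1)) kl))) (λ e → e) ,
                   rim-link-elim (s≤s z≤n) (≤-trans (s≤s z≤n) kl) (λ e → e) (λ e → absurd-≡> e (≤-trans kl (n≤1+n k)))
                        (λ e _ → absurd-≡< e (≤-trans vm m≤N)) (λ e _ → absurd-< v1 (≤-reflexive (suc-injective e)))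

  hub-high-inside : ∀ v′ y → m ≤ v′ → suc v′ ≤ N → 2 ≤ y → y ≤ v′ → Through 0 (suc v′) y
  hub-high-inside v′ y mv vN y2 yv = through-interval m v′ y 2 v′ link-0-m (link-down v1 vN)
      (s≤s z≤n) (≤-trans (n≤1+n v′) vN) adm (≤-trans (s≤s (s≤s z≤n)) 3≤m) mv y2 yv (≤-trans (≤-trans (s≤s (s≤s z≤n)) 3≤m) mv) ≤-refl
    where
      v1 : 1 ≤ v′
      v1 = ≤-trans (s≤s z≤n) mv
      adm : ∀ k → 2 ≤ k → k ≤ v′ → Adm 0 (suc v′) m v′ k
      adm k k2 kv = hub-link-elim (≤-trans (s≤s z≤n) k2) (λ e → absurd-≡> e k2) (λ e → e) ,
                   rim-link-elim (s≤s z≤n) (≤-trans (s≤s z≤n) k2) (λ e → absurd-≡< e (s≤s (≤-trans kv (n≤1+n v′)))) suc-injective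
                        (λ _ e → absurd-≡> e k2) (λ e _ → absurd-< (s≤s v1) (≤-reflexive e))

  hub-high-outside : ∀ v′ y → m ≤ v′ → suc v′ ≤ N → y ≡ 1 ⊎ (suc (suc v′) ≤ y × y ≤ N) → Through 0 (suc v′) y
  hub-high-outside v′ y mv vN hy with suc v′ ≟ N
  ... | yes v≡N with hy
  ...   | inj₂ (l , yN) = absurd-< (subst (λ z → suc z ≤ y) v≡N l) yN
  ...   | inj₁ refl = 1 , 1 , link-0-1 , subst (λ z → Link z 1) (sym v≡N) link-N-1 , ((λ _ → refl) , (λ _ → refl)) , ε , ε
  hub-high-outside v′ y mv vN hy | no vNN = 1 , suc (suc v′) , link-0-1 , link-up (s≤s z≤n) vN′ , adm-1 , path-a-y hy , path-y-b hy
    where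
      vN′ : suc (suc v′) ≤ N
      vN′ = ≤∧≢⇒< vN vNN
      v2 : 2 ≤ suc v′
      v2 = s≤s (≤-trans (s≤s z≤n) mv)
      adm-1 : Adm 0 (suc v′) 1 (suc (suc v′)) 1
      adm-1 = (λ _ → refl) , rim-link-elim (s≤s z≤n) ≤-refl (λ e → absurd-≡< e (s≤s (s≤s z≤n))) (λ e → absurd-< (s≤s (≤-trans (s≤s (s≤s z≤n)) (≤-trans 3≤m mv))) (≤-reflexive (sym e)))
                    (λ e _ → ⊥-elim (vNN e)) (λ e _ → absurd-< v2 (≤-reflexive e))
      adm : ∀ k → suc (suc v′) ≤ k → k ≤ N → Adm 0 (suc v′) 1 (suc (suc v′)) k
      adm k kl kN = hub-link-elim (≤-trans (s≤s z≤n) kl) (λ e → e) (λ e → absurd-≡> e (≤-trans (s≤s (≤-trans mv (n≤1+n v′))) kl)) ,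
                   rim-link-elim (s≤s z≤n) (≤-trans (s≤s z≤n) kl) (λ e → e) (λ e → absurd-≡> e (≤-trans kl (n≤1+n k)))
                        (λ e _ → ⊥-elim (vNN e)) (λ e _ → absurd-< v2 (≤-reflexive e))
      step-1-N : StepIn (Adm 0 (suc v′) 1 (suc (suc v′))) 1 N
      step-1-N = link-1-N , adm-1 , adm N vN′ ≤-refl , 1≤N , ≤-refl
      path : ∀ i j → suc (suc v′) ≤ i → i ≤ N → suc (suc v′) ≤ j → j ≤ N → Star (StepIn (Adm 0 (suc v′) 1 (suc (suc v′)))) i j
      path = interval-path (suc (suc v′)) N (s≤s z≤n) ≤-refl adm
      path-a-y : y ≡ 1 ⊎ (suc (suc v′) ≤ y × y ≤ N) → Star (StepIn (Adm 0 (suc v′) 1 (suc (suc v′)))) 1 y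
      path-a-y (inj₁ refl) = ε
      path-a-y (inj₂ (l , yN)) = step-1-N ◅ path N y vN′ ≤-refl l yN
      path-y-b : y ≡ 1 ⊎ (suc (suc v′) ≤ y × y ≤ N) → Star (StepIn (Adm 0 (suc v′) 1 (suc (suc v′)))) y (suc (suc v′))
      path-y-b (inj₁ refl) = step-1-N ◅ path N (suc (suc v′)) vN′ ≤-refl ≤-refl vN′
      path-y-b (inj₂ (l , yN)) = path y (suc (suc v′)) l yN ≤-refl vN′

  rim-inside : ∀ u v′ y → 1 ≤ u → suc u ≤ v′ → suc v′ ≤ N → suc u ≤ y → y ≤ v′ → Through u (suc v′) y
  rim-inside u v′ y u1 uv vN yl yv = through-interval (suc u) v′ y (suc u) v′ (link-up u1 (≤-trans uv (≤-trans (n≤1+n v′) vN)))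
      (link-down v1 vN) (s≤s z≤n) (≤-trans (n≤1+n v′) vN) adm ≤-refl uv yl yv uv ≤-refl
    where
      v1 : 1 ≤ v′
      v1 = ≤-trans (s≤s z≤n) uv
      adm : ∀ k → suc u ≤ k → k ≤ v′ → Adm u (suc v′) (suc u) v′ k
      adm k kl kv = rim-link-elim u1 (≤-trans (s≤s z≤n) kl) (λ e → e) (λ e → absurd-≡> e (≤-trans kl (n≤1+n k)))
                        (λ e _ → absurd-≡< e (≤-trans (s≤s (≤-trans (n≤1+n u) uv)) vN))
                        (λ _ e → absurd-≡< e (≤-trans (s≤s kv) vN)) ,
                   rim-link-elim (s≤s z≤n) (≤-trans (s≤s z≤n) kl) (λ e → absurd-≡< e (s≤s (≤-trans kv (n≤1+n v′)))) suc-injective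
                        (λ _ e → absurd-≡> e (≤-trans (s≤s (s≤s z≤n)) (≤-trans (s≤s u1) kl)))
                        (λ e _ → absurd-< (≤-trans (s≤s z≤n) uv) (≤-reflexive (suc-injective e)))

  rim-from-1-outside : ∀ v′ y → 2 ≤ v′ → suc (suc v′) ≤ N → suc (suc v′) ≤ y → y ≤ N → Through 1 (suc v′) y
  rim-from-1-outside v′ y v2 vN yl yN = through-interval N (suc (suc v′)) y (suc (suc v′)) N link-1-N (link-up (s≤s z≤n) vN) (s≤s z≤n) ≤-refl adm
      vN ≤-refl yl yN ≤-refl vN
    where
      adm : ∀ k → suc (suc v′) ≤ k → k ≤ N → Adm 1 (suc v′) N (suc (suc v′)) k
      adm k kl kN = rim-link-elim ≤-refl (≤-trans (s≤s z≤n) kl) (λ e → absurd-≡> e (≤-trans (s≤s (s≤s (s≤s z≤n))) (≤-trans (s≤s (s≤s v2)) kl)))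
                        (λ e → absurd-≡> e (s≤s (≤-trans (s≤s z≤n) kl)))
                        (λ e _ → absurd-< (≤-trans (s≤s (s≤s z≤n)) (≤-trans (s≤s (s≤s v2)) vN)) (≤-reflexive (sym e)))
                        (λ _ e → e) ,
                   rim-link-elim (s≤s z≤n) (≤-trans (s≤s z≤n) kl) (λ e → e) (λ e → absurd-≡> e (≤-trans kl (n≤1+n k)))
                        (λ e _ → absurd-≡< e vN) (λ e _ → absurd-< (≤-trans (s≤s z≤n) v2) (≤-reflexive (suc-injective e)))

  module ToN (u′ : ℕ) (u1 : 1 ≤ u′) (uN : suc (suc u′) ≤ N) where

    adm : ∀ k → 1 ≤ k → k ≤ u′ → Adm (suc u′) N u′ 1 k
    adm k k1 ku = rim-link-elim (s≤s z≤n) k1 (λ e → absurd-≡< e (s≤s (≤-trans ku (n≤1+n u′)))) suc-injective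
                    (λ e _ → absurd-≡< e uN) (λ e _ → absurd-< u1 (≤-reflexive (suc-injective e))) ,
                  rim-link-elim 1≤N k1 (λ e → absurd-≡< e (s≤s (≤-trans ku u′N)))
                    (λ e → absurd-≡< e (≤-trans (s≤s (s≤s ku)) uN))
                    (λ _ e → e) (λ e _ → absurd-< (≤-trans (s≤s (s≤s z≤n)) (≤-trans (s≤s (s≤s u1)) uN)) (≤-reflexive e))
      where
        u′N : u′ ≤ N
        u′N = ≤-trans (n≤1+n u′) (≤-trans (n≤1+n _) uN)

    path : ∀ i j → 1 ≤ i → i ≤ u′ → 1 ≤ j → j ≤ u′ → Star (StepIn (Adm (suc u′) N u′ 1)) i j
    path = interval-path 1 u′ ≤-refl (≤-trans (n≤1+n u′) (≤-trans (n≤1+n _) uN)) adm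

    link-u-u′ : Link (suc u′) u′
    link-u-u′ = link-down u1 (≤-trans (n≤1+n _) uN)

    outside : ∀ y → 1 ≤ y → y ≤ u′ → Through (suc u′) N y
    outside y y1 yu = u′ , 1 , link-u-u′ , link-N-1 , adm u′ u1 ≤-refl , path u′ y u1 ≤-refl y1 yu , path y 1 y1 yu ≤-refl u1

    hub : suc u′ ≢ m → Through (suc u′) N 0
    hub um = u′ , 1 , link-u-u′ , link-N-1 , adm u′ u1 ≤-refl ,
      path u′ 1 u1 ≤-refl ≤-refl u1 ◅◅ (link-1-0 , adm 1 ≤-refl u1 , adm-0 , 1≤N , z≤n) ◅ ε ,
      (link-0-1 , adm-0 , adm 1 ≤-refl u1 , z≤n , 1≤N) ◅ ε
      where
        adm-0 : Adm (suc u′) N u′ 1 0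
        adm-0 = link-hub-elim (λ e → absurd-< u1 (≤-reflexive (suc-injective e))) (λ e → ⊥-elim (um e)) ,
                link-hub-elim (λ e → absurd-< (≤-trans (s≤s (s≤s z≤n)) (≤-trans (s≤s (s≤s u1)) uN)) (≤-reflexive e))
                              (λ e → absurd-< m<N (≤-reflexive e))

  module Rim (u′ v : ℕ) (u1 : 1 ≤ u′) (uv : suc (suc (suc u′)) ≤ v) (vN : suc v ≤ N) where

    A : ℕ → Set
    A = Adm (suc u′) v u′ (suc v)

    adm-low : ∀ k → 1 ≤ k → k ≤ u′ → A k
    adm-low k k1 ku =
      rim-link-elim (s≤s z≤n) k1 (λ e → absurd-≡< e (s≤s (≤-trans ku (n≤1+n u′)))) suc-injective
        (λ e _ → absurd-≡< e (≤-trans (≤-trans (s≤s (n≤1+n _)) uv) (<⇒≤ vN))) (λ e _ → absurd-< u1 (≤-reflexive (suc-injective e))) ,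
      rim-link-elim (≤-trans (s≤s z≤n) uv) k1 (λ e → absurd-≡< e (s≤s (≤-trans ku (≤-trans (n≤1+n _) (≤-trans (n≤1+n _) (≤-trans (n≤1+n _) uv))))))
        (λ e → absurd-≡< e (≤-trans (s≤s (s≤s ku)) (≤-trans (n≤1+n _) uv)))
        (λ e _ → absurd-≡< e vN) (λ e _ → absurd-< (≤-trans (s≤s (s≤s z≤n)) uv) (≤-reflexive e))

    adm-high : ∀ k → suc v ≤ k → k ≤ N → A k
    adm-high k kl kN =
      rim-link-elim (s≤s z≤n) (≤-trans (s≤s z≤n) kl) (λ e → absurd-≡> e (≤-trans uv (≤-trans (n≤1+n v) kl)))
        (λ e → absurd-≡> e (s≤s (≤-trans (n≤1+n (suc u′)) (≤-trans (n≤1+n _) (≤-trans uv (≤-trans (n≤1+n v) kl))))))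
        (λ e _ → absurd-≡< e (≤-trans (≤-trans (n≤1+n _) uv) (<⇒≤ vN))) (λ e _ → absurd-< u1 (≤-reflexive (suc-injective e))) ,
      rim-link-elim (≤-trans (s≤s z≤n) uv) (≤-trans (s≤s z≤n) kl) (λ e → e) (λ e → absurd-≡> e (≤-trans kl (n≤1+n k)))
        (λ e _ → absurd-≡< e vN) (λ e _ → absurd-< (≤-trans (s≤s (s≤s z≤n)) uv) (≤-reflexive e))

    path-low : ∀ i j → 1 ≤ i → i ≤ u′ → 1 ≤ j → j ≤ u′ → Star (StepIn A) i j
    path-low = interval-path 1 u′ ≤-refl
      (≤-trans (n≤1+n _) (≤-trans (n≤1+n _) (≤-trans (n≤1+n _) (≤-trans uv (≤-trans (n≤1+n _) vN))))) adm-low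

    path-high : ∀ i j → suc v ≤ i → i ≤ N → suc v ≤ j → j ≤ N → Star (StepIn A) i j
    path-high = interval-path (suc v) N (s≤s z≤n) ≤-refl adm-high

    low-to-high : ∀ i j → 1 ≤ i → i ≤ u′ → suc v ≤ j → j ≤ N → Star (StepIn A) i j
    low-to-high i j i1 iu jl jN =
      path-low i 1 i1 iu ≤-refl u1 ◅◅ (link-1-N , adm-low 1 ≤-refl u1 , adm-high N vN ≤-refl , 1≤N , ≤-refl) ◅ path-high N j vN ≤-refl jl jN

    link-u-u′ : Link (suc u′) u′
    link-u-u′ = link-down u1 (≤-trans (s≤s (n≤1+n _)) (≤-trans (≤-trans (n≤1+n _) uv) (<⇒≤ vN)))

    link-v-v+1 : Link v (suc v)
    link-v-v+1 = link-up (≤-trans (s≤s z≤n) uv) vN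

    outside : ∀ y → (1 ≤ y × y ≤ u′) ⊎ (suc v ≤ y × y ≤ N) → Through (suc u′) v y
    outside y (inj₁ (y1 , yu)) = u′ , suc v , link-u-u′ , link-v-v+1 , adm-low u′ u1 ≤-refl ,
      path-low u′ y u1 ≤-refl y1 yu , low-to-high y (suc v) y1 yu ≤-refl vN
    outside y (inj₂ (yl , yN)) = u′ , suc v , link-u-u′ , link-v-v+1 , adm-low u′ u1 ≤-refl ,
      low-to-high u′ y u1 ≤-refl yl yN , path-high y (suc v) yl yN ≤-refl vN

    hub : suc u′ ≢ m → v ≢ m → Through (suc u′) v 0
    hub um vm = u′ , suc v , link-u-u′ , link-v-v+1 , adm-low u′ u1 ≤-refl ,
      path-low u′ 1 u1 ≤-refl ≤-refl u1 ◅◅ (link-1-0 , adm-low 1 ≤-refl u1 , adm-0 , 1≤N , z≤n) ◅ ε ,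
      (link-0-1 , adm-0 , adm-low 1 ≤-refl u1 , z≤n , 1≤N) ◅ low-to-high 1 (suc v) ≤-refl u1 ≤-refl vN
      where
        adm-0 : A 0
        adm-0 = link-hub-elim (λ e → absurd-< u1 (≤-reflexive (suc-injective e))) (λ e → ⊥-elim (um e)) ,
                link-hub-elim (λ e → absurd-< (≤-trans (s≤s (s≤s z≤n)) uv) (≤-reflexive e)) (λ e → ⊥-elim (vm e))

  spokes-hub : Through 1 m 0
  spokes-hub = 0 , 0 , link-1-0 , link-m-0 , ((λ _ → refl) , (λ _ → refl)) , ε , ε

  4≤m : 4 ≤ m
  4≤m = s≤s 3≤m₁

  from-1-high-hub : ∀ v′ → m ≤ v′ → suc (suc v′) ≤ N → Through 1 (suc v′) 0
  from-1-high-hub v′ mv vN = 0 , v′ , link-1-0 , link-down v1 (<⇒≤ vN) , adm-0 , ε , (link-0-m , adm-0 , adm m ≤-refl mv , z≤n , m≤N) ◅ interval-path m v′ (≤-trans (s≤s z≤n) 3≤m) v′N adm m v′ ≤-refl mv mv ≤-refl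
    where
      v1 : 1 ≤ v′
      v1 = ≤-trans (s≤s z≤n) mv
      v′N : v′ ≤ N
      v′N = ≤-trans (n≤1+n _) (≤-trans (n≤1+n _) vN)
      adm-0 : Adm 1 (suc v′) 0 v′ 0
      adm-0 = (λ _ → refl) , link-hub-elim (λ e → absurd-< (s≤s v1) (≤-reflexive e)) (λ e → absurd-< (s≤s mv) (≤-reflexive e))
      adm : ∀ k → m ≤ k → k ≤ v′ → Adm 1 (suc v′) 0 v′ k
      adm k mk kv = rim-link-elim ≤-refl k1 (λ e → absurd-≡> e (≤-trans 3≤m mk)) (λ e → absurd-≡> e (s≤s k1))
                        (λ e _ → absurd-< (≤-trans (s≤s (s≤s z≤n)) (≤-trans (s≤s (s≤s v1)) vN)) (≤-reflexive (sym e)))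
                        (λ _ e → absurd-≡< e (≤-trans (s≤s kv) (<⇒≤ vN))) ,
                   rim-link-elim (s≤s z≤n) k1 (λ e → absurd-≡< e (s≤s (≤-trans kv (n≤1+n _)))) suc-injective
                        (λ e _ → absurd-≡< e vN) (λ e _ → absurd-< (s≤s v1) (≤-reflexive e))
        where k1 : 1 ≤ k
              k1 = ≤-trans (s≤s z≤n) mk

  from-1-low-hub : ∀ v → 3 ≤ v → v < m → Through 1 v 0
  from-1-low-hub v v3 vm = 0 , suc v , link-1-0 , link-up (≤-trans (s≤s z≤n) v3) (≤-trans vm m≤N) , adm-0 , ε ,
      (link-0-m , adm-0 , adm m vm ≤-refl , z≤n , m≤N) ◅ interval-path (suc v) m (s≤s z≤n) m≤N adm m (suc v) vm ≤-refl ≤-refl vm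
    where
      adm-0 : Adm 1 v 0 (suc v) 0
      adm-0 = (λ _ → refl) , link-hub-elim (λ e → absurd-< (≤-trans (s≤s (s≤s z≤n)) v3) (≤-reflexive e)) (λ e → absurd-≡< e vm)
      adm : ∀ k → suc v ≤ k → k ≤ m → Adm 1 v 0 (suc v) k
      adm k vk km = rim-link-elim ≤-refl k1 (λ e → absurd-≡> e (≤-trans v3 (≤-trans (n≤1+n v) vk))) (λ e → absurd-≡> e (s≤s k1))
                        (λ e _ → absurd-< (≤-trans (s≤s (s≤s z≤n)) (≤-trans (s≤s 3≤m) m<N)) (≤-reflexive (sym e)))
                        (λ _ e → absurd-≡< e (≤-trans (s≤s km) m<N)) ,
                   rim-link-elim (≤-trans (s≤s z≤n) v3) k1 (λ e → e) (λ e → absurd-≡> e (≤-trans vk (n≤1+n k)))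
                        (λ e _ → absurd-≡< e (≤-trans vm m≤N)) (λ e _ → absurd-< (≤-trans (s≤s (s≤s z≤n)) v3) (≤-reflexive e))
        where k1 : 1 ≤ k
              k1 = ≤-trans (s≤s z≤n) vk

  link-m-1-elim : ∀ {c} → Link m 1 → 1 ≡ c
  link-m-1-elim = rim-link-elim (≤-trans (s≤s z≤n) 3≤m) ≤-refl (λ e → absurd-≡< e (s≤s (s≤s z≤n))) (λ e → absurd-< (≤-trans (s≤s (s≤s (s≤s z≤n))) 4≤m) (≤-reflexive (sym e)))
             (λ e _ → absurd-< m<N (≤-reflexive (sym e))) (λ e _ → absurd-< (≤-trans (s≤s (s≤s z≤n)) 3≤m) (≤-reflexive e))

  from-m-to-N-hub : Through m N 0
  from-m-to-N-hub = 0 , 1 , link-m-0 , link-N-1 , adm-0 , ε , (link-0-1 , adm-0 , adm-1 , z≤n , 1≤N) ◅ ε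
    where
      adm-0 : Adm m N 0 1 0
      adm-0 = (λ _ → refl) , link-hub-elim (λ e → absurd-< (≤-trans (s≤s (s≤s z≤n)) (≤-trans 3≤m m≤N)) (≤-reflexive e)) (λ e → absurd-< m<N (≤-reflexive e))
      adm-1 : Adm m N 0 1 1
      adm-1 = link-m-1-elim , (λ _ → refl)

  from-m-hub : ∀ v′ → m ≤ v′ → suc (suc v′) ≤ N → Through m (suc v′) 0
  from-m-hub v′ mv vN = 0 , suc (suc v′) , link-m-0 , link-up (s≤s z≤n) vN , adm-0 , ε ,
      (link-0-1 , adm-0 , adm-1 , z≤n , 1≤N) ◅ (link-1-N , adm-1 , adm N vN ≤-refl , 1≤N , ≤-refl) ◅ interval-path (suc (suc v′)) N (s≤s z≤n) ≤-refl adm N (suc (suc v′)) vN ≤-refl ≤-refl vN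
    where
      adm-0 : Adm m (suc v′) 0 (suc (suc v′)) 0
      adm-0 = (λ _ → refl) , link-hub-elim (λ e → absurd-< (s≤s (≤-trans (s≤s z≤n) mv)) (≤-reflexive e)) (λ e → absurd-< (s≤s mv) (≤-reflexive e))
      adm-1 : Adm m (suc v′) 0 (suc (suc v′)) 1
      adm-1 = link-m-1-elim , rim-link-elim (s≤s z≤n) ≤-refl (λ e → absurd-≡< e (s≤s (s≤s z≤n))) (λ e → absurd-< (s≤s (≤-trans (s≤s (s≤s z≤n)) (≤-trans 3≤m mv))) (≤-reflexive (sym e)))
                      (λ e _ → absurd-≡< e vN) (λ e _ → absurd-< (s≤s (≤-trans (s≤s z≤n) mv)) (≤-reflexive e))
      adm : ∀ k → suc (suc v′) ≤ k → k ≤ N → Adm m (suc v′) 0 (suc (suc v′)) k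
      adm k vk kN = rim-link-elim (≤-trans (s≤s z≤n) 3≤m) k1 (λ e → absurd-≡> e (≤-trans (s≤s (s≤s mv)) vk)) (λ e → absurd-≡> e (s≤s (≤-trans mv (≤-trans (n≤1+n _) (≤-trans (n≤1+n _) vk)))))
                        (λ e _ → absurd-< m<N (≤-reflexive (sym e))) (λ e _ → absurd-< (≤-trans (s≤s (s≤s z≤n)) 3≤m) (≤-reflexive e)) ,
                   rim-link-elim (s≤s z≤n) k1 (λ e → e) (λ e → absurd-≡> e (≤-trans vk (n≤1+n k)))
                        (λ e _ → absurd-≡< e vN) (λ e _ → absurd-< (s≤s (≤-trans (s≤s z≤n) mv)) (≤-reflexive e))
        where k1 : 1 ≤ k
              k1 = ≤-trans (s≤s z≤n) vk

  to-m-hub : ∀ u′ → 1 ≤ u′ → suc (suc (suc u′)) ≤ m → Through (suc u′) m 0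
  to-m-hub u′ u1 um = u′ , 0 , link-down u1 uN , link-m-0 , adm u′ u1 ≤-refl ,
      interval-path 1 u′ ≤-refl u′N adm u′ 1 u1 ≤-refl ≤-refl u1 ◅◅ (link-1-0 , adm 1 ≤-refl u1 , adm-0 , 1≤N , z≤n) ◅ ε , ε
    where
      uN : suc u′ ≤ N
      uN = ≤-trans (n≤1+n _) (≤-trans (n≤1+n _) (≤-trans um m≤N))
      u′N : u′ ≤ N
      u′N = ≤-trans (n≤1+n _) uN
      adm-0 : Adm (suc u′) m u′ 0 0
      adm-0 = link-hub-elim (λ e → absurd-< u1 (≤-reflexive (suc-injective e))) (λ e → absurd-≡< e (≤-trans (n≤1+n _) um)) , (λ _ → refl)
      adm : ∀ k → 1 ≤ k → k ≤ u′ → Adm (suc u′) m u′ 0 k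
      adm k k1 ku = rim-link-elim (s≤s z≤n) k1 (λ e → absurd-≡< e (s≤s (≤-trans ku (n≤1+n _)))) suc-injective
                        (λ e _ → absurd-≡< e (≤-trans (n≤1+n _) (≤-trans um m≤N))) (λ e _ → absurd-< u1 (≤-reflexive (suc-injective e))) ,
                   rim-link-elim (≤-trans (s≤s z≤n) 3≤m) k1 (λ e → absurd-≡< e (s≤s (≤-trans ku (≤-trans (n≤1+n _) (≤-trans (n≤1+n _) (≤-trans (n≤1+n _) um))))))
                        (λ e → absurd-≡< e (≤-trans (s≤s (s≤s ku)) (≤-trans (n≤1+n _) um)))
                        (λ e _ → absurd-< m<N (≤-reflexive (sym e))) (λ e _ → absurd-< (≤-trans (s≤s (s≤s z≤n)) 3≤m) (≤-reflexive e))

  through-rim-hub : ∀ u₀ v′ → suc v′ ≤ N → suc (suc u₀) ≤ v′ → ¬ Link (suc u₀) (suc v′) → Through (suc u₀) (suc v′) 0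
  through-rim-hub zero v′ vN uv na with suc v′ ≟ m
  ... | yes e = subst (λ z → Through 1 z 0) (sym e) spokes-hub
  ... | no vm with suc v′ <? m
  ...   | yes vlt = from-1-low-hub (suc v′) (s≤s uv) vlt
  ...   | no vge = from-1-high-hub v′ (≤-pred (≤∧≢⇒< (≮⇒≥ vge) (≢-sym vm))) (≤∧≢⇒< vN (λ e → na (subst (Link 1) (sym e) link-1-N)))
  through-rim-hub (suc u′) v′ vN uv na with suc (suc u′) ≟ m
  ... | yes eu with suc v′ ≟ N
  ...   | yes ev = subst₂ (λ a b → Through a b 0) (sym eu) (sym ev) from-m-to-N-hub
  ...   | no vn = subst (λ a → Through a (suc v′) 0) (sym eu) (from-m-hub v′ (≤-trans (≤-trans (≤-reflexive (sym eu)) (n≤1+n _)) uv) (≤∧≢⇒< vN vn))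
  through-rim-hub (suc u′) v′ vN uv na | no um with suc v′ ≟ m
  ... | yes ev = subst (λ b → Through (suc (suc u′)) b 0) (sym ev) (to-m-hub (suc u′) (s≤s z≤n) (≤-trans (s≤s uv) (≤-reflexive ev)))
  ... | no vm with suc v′ ≟ N
  ...   | yes ev = subst (λ b → Through (suc (suc u′)) b 0) (sym ev) (ToN.hub (suc u′) (s≤s z≤n) (≤-trans (s≤s (≤-trans (n≤1+n _) uv)) vN) um)
  ...   | no vn = Rim.hub (suc u′) (suc v′) (s≤s z≤n) (s≤s uv) (≤∧≢⇒< vN vn) um vm

  through-rim-rim : ∀ u₀ v′ y → suc v′ ≤ N → y ≤ N → suc (suc u₀) ≤ v′ → ¬ Link (suc u₀) (suc v′) →
    y ≢ 0 → y ≢ suc u₀ → y ≢ suc v′ → Through (suc u₀) (suc v′) y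
  through-rim-rim u₀ v′ y vN yN uv na y0 yu yv with suc u₀ <? y
  ... | yes l1 with y ≤? v′
  ...   | yes l2 = rim-inside (suc u₀) v′ y (s≤s z≤n) uv vN l1 l2
  ...   | no l2 = above u₀ uv na
    where
      yl : suc (suc v′) ≤ y
      yl = ≤∧≢⇒< (≰⇒> l2) (≢-sym yv)
      above : ∀ u₀ → suc (suc u₀) ≤ v′ → ¬ Link (suc u₀) (suc v′) → Through (suc u₀) (suc v′) y
      above zero uv na = rim-from-1-outside v′ y uv (≤∧≢⇒< vN (λ e → na (subst (Link 1) (sym e) link-1-N))) yl yN
      above (suc u′) uv na = Rim.outside (suc u′) (suc v′) (s≤s z≤n) (s≤s uv) (≤-trans yl yN) y (inj₂ (yl , yN))
  through-rim-rim zero v′ y vN yN uv na y0 yu yv | no l1 = ⊥-elim (y0 (n≤0⇒n≡0 (≤-pred (≤∧≢⇒< (≮⇒≥ l1) yu))))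
  through-rim-rim (suc u′) v′ y vN yN uv na y0 yu yv | no l1 with suc v′ ≟ N
  ... | yes ev = subst (λ b → Through (suc (suc u′)) b y) (sym ev)
                   (ToN.outside (suc u′) (s≤s z≤n) (≤-trans (s≤s (≤-trans (n≤1+n _) uv)) vN) y (n≢0⇒n>0 y0) (≤-pred (≤∧≢⇒< (≮⇒≥ l1) yu)))
  ... | no vn = Rim.outside (suc u′) (suc v′) (s≤s z≤n) (s≤s uv) (≤∧≢⇒< vN vn) y (inj₁ (n≢0⇒n>0 y0 , ≤-pred (≤∧≢⇒< (≮⇒≥ l1) yu)))

  beyond-m : ∀ {v} → ¬ Link 0 v → ¬ v < m → m < v
  beyond-m na v≮m = ≤∧≢⇒< (≮⇒≥ v≮m) (λ e → na (subst (Link 0) e link-0-m))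

  through-hub : ∀ v′ y → suc v′ ≤ N → y ≤ N → ¬ Link 0 (suc v′) → y ≢ 0 → y ≢ suc v′ → Through 0 (suc v′) y
  through-hub zero _ _ _ na _ _ = ⊥-elim (na link-0-1)
  through-hub (suc v″) y vN yN na yu yv with suc (suc v″) <? m
  ... | yes vm with y ≤? suc v″
  ...   | yes yv′ = hub-low-inside (suc v″) y (s≤s z≤n) vm (n≢0⇒n>0 yu) yv′
  ...   | no yv′ = hub-low-outside (suc v″) y (s≤s z≤n) vm (≤∧≢⇒< (≰⇒> yv′) (≢-sym yv)) yN
  through-hub (suc v″) y vN yN na yu yv | no nvm with y ≟ 1 | y ≤? suc v″
  ... | yes refl | _ = hub-high-outside (suc v″) y (≤-pred (beyond-m na nvm)) vN (inj₁ refl)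
  ... | no y1 | yes yv′ = hub-high-inside (suc v″) y (≤-pred (beyond-m na nvm)) vN (≤∧≢⇒< (n≢0⇒n>0 yu) (≢-sym y1)) yv′
  ... | no _ | no yv′ = hub-high-outside (suc v″) y (≤-pred (beyond-m na nvm)) vN (inj₂ (≤∧≢⇒< (≰⇒> yv′) (≢-sym yv) , yN))

  rim-gap : ∀ {u₀ v′} → suc u₀ < suc v′ → suc v′ ≤ N → ¬ Link (suc u₀) (suc v′) → suc (suc u₀) ≤ v′
  rim-gap uv vN na = ≤∧≢⇒< (≤-pred uv) (λ { refl → na (link-up (s≤s z≤n) vN) })

  through-< : ∀ u v y → v ≤ N → y ≤ N → u < v → ¬ Link u v → y ≢ u → y ≢ v → Through u v y
  through-< zero (suc v′) y vN yN _ na yu yv = through-hub v′ y vN yN na yu yv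
  through-< (suc u₀) (suc v′) y vN yN uv na yu yv with y ≟ 0
  ... | yes refl = through-rim-hub u₀ v′ vN (rim-gap uv vN na) na
  ... | no y0 = through-rim-rim u₀ v′ y vN yN (rim-gap uv vN na) na y0 yu yv

  n : ℕ
  n = m + m

  RimEdge? : ∀ p q → Dec (RimEdge p q)
  RimEdge? p q = ((1 ≤? p) ×-dec (suc p ≟ q) ×-dec (q ≤? N)) ⊎-dec ((p ≟ N) ×-dec (q ≟ 1))

  Spoke? : ∀ p q → Dec (Spoke p q)
  Spoke? p q = (p ≟ 0) ×-dec ((q ≟ 1) ⊎-dec (q ≟ m))

  Link? : ∀ p q → Dec (Link p q)
  Link? p q = RimEdge? p q ⊎-dec RimEdge? q p ⊎-dec Spoke? p q ⊎-dec Spoke? q p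

  RimEdge-irrefl : ∀ {p} → ¬ RimEdge p p
  RimEdge-irrefl {p} (inj₁ (_ , e , _)) = <-irrefl (sym e) (n<1+n p)
  RimEdge-irrefl (inj₂ (refl , e)) = <-irrefl (sym e) (≤-trans (s≤s (s≤s z≤n)) (≤-trans 3≤m m≤N))

  Link-irrefl : ∀ {p} → ¬ Link p p
  Link-irrefl (inj₁ r) = RimEdge-irrefl r
  Link-irrefl (inj₂ (inj₁ r)) = RimEdge-irrefl r
  Link-irrefl (inj₂ (inj₂ (inj₁ (refl , inj₁ ()))))
  Link-irrefl (inj₂ (inj₂ (inj₁ (refl , inj₂ ()))))
  Link-irrefl (inj₂ (inj₂ (inj₂ (refl , inj₁ ()))))
  Link-irrefl (inj₂ (inj₂ (inj₂ (refl , inj₂ ()))))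

  C : Graph n
  C = record { adj = λ p q → ⌊ Link? (toℕ p) (toℕ q) ⌋
             ; sym = λ p q → ⌊⌋-cong (Link? _ _) (Link? _ _) (mk⇔ Link-sym Link-sym)
             ; irrefl = λ p → ⌊⌋-false (Link? _ _) Link-irrefl }

  open TollWalks C

  link⇒~ : ∀ {p q : Fin n} → Link (toℕ p) (toℕ q) → p ~ q
  link⇒~ = ⌊⌋-true (Link? _ _)

  ~⇒link : ∀ {p q : Fin n} → p ~ q → Link (toℕ p) (toℕ q)
  ~⇒link = ⌊⌋-true⁻ (Link? _ _)

  -- junk value zero above N
  vertex : ℕ → Fin n
  vertex k with k <? n
  ... | yes k<n = fromℕ< k<n
  ... | no _ = zero

  toℕ-vertex : ∀ {k} → k ≤ N → toℕ (vertex k) ≡ k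
  toℕ-vertex {k} k≤N with k <? n
  ... | yes k<n = toℕ-fromℕ< k<n
  ... | no k≮n = ⊥-elim (k≮n (s≤s k≤N))

  toℕ≤N : ∀ (x : Fin n) → toℕ x ≤ N
  toℕ≤N x = ≤-pred (toℕ<n x)

  vertex-toℕ : ∀ (x : Fin n) → vertex (toℕ x) ≡ x
  vertex-toℕ x = toℕ-injective (toℕ-vertex (toℕ≤N x))

  Link-≤N : ∀ {p q} → Link p q → p ≤ N → q ≤ N
  Link-≤N (inj₁ (inj₁ (_ , refl , q≤N))) _ = q≤N
  Link-≤N (inj₁ (inj₂ (_ , refl))) _ = 1≤N
  Link-≤N (inj₂ (inj₁ (inj₁ (_ , refl , _)))) p≤N = ≤-trans (n≤1+n _) p≤N
  Link-≤N (inj₂ (inj₁ (inj₂ (refl , _)))) _ = ≤-refl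
  Link-≤N (inj₂ (inj₂ (inj₁ (_ , inj₁ refl)))) _ = 1≤N
  Link-≤N (inj₂ (inj₂ (inj₁ (_ , inj₂ refl)))) _ = m≤N
  Link-≤N (inj₂ (inj₂ (inj₂ (refl , _)))) _ = z≤n

  path-end : ∀ {A p q} → Star (StepIn A) p q → A p → A q
  path-end ε ap = ap
  path-end ((_ , _ , aq , _) ◅ s) _ = path-end s aq

  swap-step : ∀ {u v a b p q} → StepIn (Adm u v a b) p q → StepIn (Adm v u b a) q p
  swap-step (pq , (pu , pv) , (qu , qv) , p≤N , q≤N) = Link-sym pq , (qv , qu) , (pv , pu) , q≤N , p≤N

  Through-sym : ∀ {u v y} → Through u v y → Through v u y
  Through-sym (a , b , ua , vb , adm-a , s₁ , s₂) =
    b , a , vb , ua , (proj₂ adm-b , proj₁ adm-b) , Star.reverse swap-step s₂ , Star.reverse swap-step s₁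
    where
      adm-b : Adm _ _ a b b
      adm-b = path-end s₂ (path-end s₁ adm-a)

  through : ∀ {u v y} → u ≤ N → v ≤ N → y ≤ N → u ≢ v → ¬ Link u v → y ≢ u → y ≢ v → Through u v y
  through {u} {v} {y} u≤N v≤N y≤N u≢v u≁v y≢u y≢v with <-cmp u v
  ... | tri< u<v _ _ = through-< u v y v≤N y≤N u<v u≁v y≢u y≢v
  ... | tri≈ _ u≡v _ = ⊥-elim (u≢v u≡v)
  ... | tri> _ _ v<u = Through-sym (through-< v u y u≤N y≤N v<u (λ l → u≁v (Link-sym l)) y≢v y≢u)

  InT-of-Through : ∀ {u v : Fin n} {z} → u ≢ v → adj C u v ≡ false → Through (toℕ u) (toℕ v) z →
    ∀ {y} → y ≡ u ⊎ y ≡ v ⊎ y ≡ vertex z → InT C u v y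
  InT-of-Through {u} {v} {z} u≢v u≁v (a , b , ua , vb , adm-a , s₁ , s₂) y∈ =
    InT-admissible-path u≢v u≁v (link⇒~ (subst (Link (toℕ u)) (sym (toℕ-vertex a≤N)) ua))
      (link⇒~ (subst (Link (toℕ v)) (sym (toℕ-vertex b≤N)) vb)) (admissible a≤N adm-a) s (on-walk y∈)
    where
      a≤N : a ≤ N
      a≤N = Link-≤N ua (toℕ≤N u)
      b≤N : b ≤ N
      b≤N = Link-≤N vb (toℕ≤N v)
      open Within (Admissible u v (vertex a) (vertex b))

      admissible : ∀ {k} → k ≤ N → Adm (toℕ u) (toℕ v) a b k → Admissible u v (vertex a) (vertex b) (vertex k)
      admissible k≤N (only-a , only-b) =
        (λ u~k → cong vertex (only-a (subst (Link (toℕ u)) (toℕ-vertex k≤N) (~⇒link u~k)))) ,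
        (λ v~k → cong vertex (only-b (subst (Link (toℕ v)) (toℕ-vertex k≤N) (~⇒link v~k))))

      step : ∀ {p q} → StepIn (Adm (toℕ u) (toℕ v) a b) p q → Step (vertex p) (vertex q)
      step (pq , adm-p , adm-q , p≤N , q≤N) =
        link⇒~ (subst₂ Link (sym (toℕ-vertex p≤N)) (sym (toℕ-vertex q≤N)) pq) , admissible p≤N adm-p , admissible q≤N adm-q

      s : Star Step (vertex a) (vertex b)
      s = Star.gmap vertex step s₁ ◅◅ Star.gmap vertex step s₂

      on-walk : ∀ {y} → y ≡ u ⊎ y ≡ v ⊎ y ≡ vertex z → y ∈ u ∷ (vertices s ++ v ∷ [])
      on-walk (inj₁ refl) = here refl
      on-walk (inj₂ (inj₁ refl)) = there (∈-++⁺ʳ _ (here refl))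
      on-walk (inj₂ (inj₂ refl)) = there (∈-++⁺ˡ (middle∈vertices (Star.gmap vertex step s₁) (Star.gmap vertex step s₂)))

  Through-Fin : ∀ {u v : Fin n} {z} → u ≢ v → adj C u v ≡ false → z ≤ N → z ≢ toℕ u → z ≢ toℕ v →
    Through (toℕ u) (toℕ v) z
  Through-Fin {u} {v} u≢v u≁v z≤N =
    through (toℕ≤N u) (toℕ≤N v) z≤N (λ e → u≢v (toℕ-injective e)) (λ l → true≢false (trans (sym (link⇒~ l)) u≁v))

  ≤2⇒≤N : ∀ {z} → z ≤ 2 → z ≤ N
  ≤2⇒≤N z≤2 = ≤-trans z≤2 (≤-trans (n≤1+n 2) (≤-trans 3≤m m≤N))

  C-toll-spanning : TollSpanning C
  C-toll-spanning {u} {v} u≢v u≁v y with y F.≟ u | y F.≟ v | ∃-other (toℕ u) (toℕ v)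
  ... | no y≢u | no y≢v | _ =
    InT-of-Through u≢v u≁v (Through-Fin u≢v u≁v (toℕ≤N y) (≢-toℕ y≢u) (≢-toℕ y≢v)) (inj₂ (inj₂ (sym (vertex-toℕ y))))
    where
      ≢-toℕ : ∀ {x} → y ≢ x → toℕ y ≢ toℕ x
      ≢-toℕ y≢x e = y≢x (toℕ-injective e)
  ... | yes y≡u | _ | z , z≤2 , z≢u , z≢v = InT-of-Through u≢v u≁v (Through-Fin u≢v u≁v (≤2⇒≤N z≤2) z≢u z≢v) (inj₁ y≡u)
  ... | no _ | yes y≡v | z , z≤2 , z≢u , z≢v = InT-of-Through u≢v u≁v (Through-Fin u≢v u≁v (≤2⇒≤N z≤2) z≢u z≢v) (inj₂ (inj₁ y≡v))

half : ℕ → ℕ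
half zero = zero
half (suc zero) = zero
half (suc (suc k)) = suc (half k)

half-double : ∀ k → half (k + k) ≡ k
half-double zero = refl
half-double (suc k) rewrite +-suc k k = cong suc (half-double k)

half-double+1 : ∀ k → half (suc (k + k)) ≡ k
half-double+1 zero = refl
half-double+1 (suc k) rewrite +-suc k k = cong suc (half-double+1 k)

data Parity : ℕ → Set where
  even : ∀ k → Parity (k + k)
  odd : ∀ k → Parity (suc (k + k))

parity : ∀ x → Parity x
parity zero = even 0
parity (suc zero) = odd 0
parity (suc (suc x)) with parity x
... | even k = subst Parity (cong suc (+-suc k k)) (even (suc k))
... | odd k = subst Parity (cong (λ z → suc (suc z)) (+-suc k k)) (odd (suc k))

double-<-cancel : ∀ {a b} → a + a < b + b → a < b
double-<-cancel {a} {b} lt with a <? b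
... | yes a<b = a<b
... | no a≮b = ⊥-elim (<⇒≱ lt (+-mono-≤ (≮⇒≥ a≮b) (≮⇒≥ a≮b)))

double-≤-cancel : ∀ {a b} → a + a ≤ b + b → a ≤ b
double-≤-cancel {a} {b} le with a ≤? b
... | yes a≤b = a≤b
... | no a≰b = ⊥-elim (<⇒≱ (+-mono-< (≰⇒> a≰b) (≰⇒> a≰b)) le)

module EvenCase (m₁ : ℕ) (3≤m₁ : 3 ≤ m₁) where
  open CycleWithHub m₁ 3≤m₁

  m+m≡ : m + m ≡ suc (suc (m₁ + m₁))
  m+m≡ = cong suc (+-suc m₁ m₁)

  -- The rim 1 … m−1 goes to the even vertices 2 … 2m−2 and m … N to the odd
  -- vertices 1 … 2m−1, so the rim becomes the long cycle of H (2m) and the spokes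
  -- become 0—2 and 0—1.
  toH : ℕ → ℕ
  toH p with p <? m
  ... | yes _ = p + p
  ... | no _ = suc ((p ∸ m) + (p ∸ m))

  toH-low : ∀ {p} → p < m → toH p ≡ p + p
  toH-low {p} lt with p <? m
  ... | yes _ = refl
  ... | no nl = ⊥-elim (nl lt)

  toH-high : ∀ k → toH (m + k) ≡ suc (k + k)
  toH-high k with (m + k) <? m
  ... | yes l = ⊥-elim (<⇒≱ l (m≤m+n m k))
  ... | no _ rewrite m+n∸m≡n m k = refl

  toC : ℕ → ℕ
  toC x with isEven x
  ... | true = half x
  ... | false = m + half x

  toC-even : ∀ k → toC (k + k) ≡ k
  toC-even k with isEven (k + k) | isEven-double k
  ... | true | _ = half-double k

  toC-odd : ∀ k → toC (suc (k + k)) ≡ m + k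
  toC-odd k with isEven (suc (k + k)) | isEven-double+1 k
  ... | false | _ = cong (m +_) (half-double+1 k)

  data Side (p : ℕ) : Set where
    low : p < m → Side p
    high : ∀ k → m + k ≡ p → Side p

  side : ∀ p → Side p
  side p with p <? m
  ... | yes l = low l
  ... | no nl = high (p ∸ m) (m+[n∸m]≡n (≮⇒≥ nl))

  toH-high′ : ∀ {p} k → m + k ≡ p → toH p ≡ suc (k + k)
  toH-high′ k refl = toH-high k

  toH-0 : toH 0 ≡ 0
  toH-0 = toH-low (s≤s z≤n)
  toH-1 : toH 1 ≡ 2
  toH-1 = toH-low (s≤s (≤-trans (s≤s z≤n) 3≤m₁))
  toH-m : toH m ≡ 1
  toH-m = toH-high′ 0 (+-identityʳ m)
  toH-N : toH N ≡ suc (m₁ + m₁)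
  toH-N = toH-high′ m₁ (+-comm m m₁)

  RimEdge⇒Edge : ∀ {p q} → RimEdge p q → Edge n (toH p) (toH q)
  RimEdge⇒Edge {p} (inj₁ (p1 , refl , qN)) with side (suc p)
  ... | low l = subst₂ (Edge n) (sym (toH-low (≤-trans (n≤1+n _) l))) (sym (toH-low l)) (inj₁ (inj₁ (cong suc (sym (+-suc p p)))))
  ... | high k e with side p
  ...   | high j e′ = subst₂ (Edge n) (sym (toH-high′ j e′)) (sym (toH-high′ (suc j) (trans (+-suc m j) (cong suc e′))))
                      (inj₁ (inj₁ (cong (λ z → suc (suc z)) (sym (+-suc j j)))))
  ...   | low l with k
  ...     | suc k′ = ⊥-elim (<-irrefl refl (≤-trans (s≤s (≤-trans (s≤s (m≤m+n m k′)) (≤-reflexive (trans (sym (+-suc m k′)) e)))) (s≤s l)))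
  ...     | zero = subst₂ (Edge n) (sym (toH-low l)) (sym (toH-high′ 0 e)) (inj₂ (inj₂ (inj₁ (refl , trans (cong (λ z → suc (suc z)) (cong₂ _+_ pm pm)) (sym m+m≡)))))
    where pm : p ≡ m₁
          pm = suc-injective (trans (sym e) (+-identityʳ m))
  RimEdge⇒Edge (inj₂ (refl , refl)) = subst₂ (Edge n) (sym toH-N) (sym toH-1) (inj₂ (inj₂ (inj₂ (refl , sym m+m≡))))

  Spoke⇒Edge : ∀ {p q} → Spoke p q → Edge n (toH p) (toH q)
  Spoke⇒Edge (refl , inj₁ refl) = subst₂ (Edge n) (sym toH-0) (sym toH-1) (inj₁ (inj₁ refl))
  Spoke⇒Edge (refl , inj₂ refl) = subst₂ (Edge n) (sym toH-0) (sym toH-m) (inj₁ (inj₂ (inj₂ (inj₁ (refl , refl)))))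

  Link⇒Edge : ∀ {p q} → Link p q → Edge n (toH p) (toH q)
  Link⇒Edge (inj₁ c) = RimEdge⇒Edge c
  Link⇒Edge (inj₂ (inj₁ c)) = Edge-sym (RimEdge⇒Edge c)
  Link⇒Edge (inj₂ (inj₂ (inj₁ h))) = Spoke⇒Edge h
  Link⇒Edge (inj₂ (inj₂ (inj₂ h))) = Edge-sym (Spoke⇒Edge h)

  m+m₁≡N : m + m₁ ≡ N
  m+m₁≡N = +-comm m m₁

  plus2⇒Link : ∀ {x y} → 2 + x ≡ y → y < n → Link (toC x) (toC y)
  plus2⇒Link {x} refl yn with parity x
  ... | even zero = link-0-1
  ... | even (suc k) = subst₂ Link (sym (toC-even (suc k))) (sym (trans (cong toC e) (toC-even (suc (suc k))))) (link-up (s≤s z≤n) kN)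
    where
      e : 2 + (suc k + suc k) ≡ suc (suc k) + suc (suc k)
      e = cong suc (sym (+-suc (suc k) (suc k)))
      kN : suc (suc k) ≤ N
      kN = ≤-trans (≤-pred (double-<-cancel (subst (_< n) e yn))) (≤-trans (n≤1+n m₁) m≤N)
  ... | odd k = subst₂ Link (sym (toC-odd k)) (sym (trans (cong toC e) (toC-odd (suc k)))) (inj₁ (inj₁ (≤-trans (s≤s z≤n) (m≤m+n m k) , sym (+-suc m k) , kN)))
    where
      e : 2 + suc (k + k) ≡ suc (suc k + suc k)
      e = cong (λ z → suc (suc z)) (sym (+-suc k k))
      kN : m + suc k ≤ N
      kN = ≤-trans (+-monoʳ-≤ m (≤-pred (double-<-cancel (≤-trans (n≤1+n _) (subst (_< n) e yn))))) (≤-reflexive m+m₁≡N)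

  Edge⇒Link : ∀ {x y} → Edge n x y → x < n → y < n → Link (toC x) (toC y)
  Edge⇒Link (inj₁ (inj₁ e)) xn yn = plus2⇒Link e yn
  Edge⇒Link (inj₁ (inj₂ (inj₁ e))) xn yn = Link-sym (plus2⇒Link e xn)
  Edge⇒Link (inj₁ (inj₂ (inj₂ (inj₁ (refl , refl))))) xn yn = inj₂ (inj₂ (inj₁ (refl , inj₂ (+-identityʳ m))))
  Edge⇒Link (inj₁ (inj₂ (inj₂ (inj₂ (refl , refl))))) xn yn = inj₂ (inj₂ (inj₂ (refl , inj₂ (+-identityʳ m))))
  Edge⇒Link {y = y} (inj₂ (inj₁ (inj₁ (refl , e)))) xn yn = subst (Link (m + 0)) (sym (trans (cong toC ye) (toC-even m₁)))
      (inj₂ (inj₁ (inj₁ (≤-trans (s≤s z≤n) 3≤m₁ , sym (+-identityʳ m) , ≤-trans (≤-reflexive (+-identityʳ m)) m≤N))))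
    where ye : y ≡ m₁ + m₁
          ye = suc-injective (suc-injective (trans e m+m≡))
  Edge⇒Link {y = y} (inj₂ (inj₁ (inj₂ (refl , e)))) xn yn = subst (Link 1) (sym (trans (cong toC ye) (toC-odd m₁)))
      (inj₂ (inj₁ (inj₂ (m+m₁≡N , refl))))
    where ye : y ≡ suc (m₁ + m₁)
          ye = suc-injective (trans e m+m≡)
  Edge⇒Link {x = x} (inj₂ (inj₂ (inj₁ (refl , e)))) xn yn = Link-sym (subst (Link (m + 0)) (sym (trans (cong toC xe) (toC-even m₁)))
      (inj₂ (inj₁ (inj₁ (≤-trans (s≤s z≤n) 3≤m₁ , sym (+-identityʳ m) , ≤-trans (≤-reflexive (+-identityʳ m)) m≤N)))))
    where xe : x ≡ m₁ + m₁
          xe = suc-injective (suc-injective (trans e m+m≡))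
  Edge⇒Link {x = x} (inj₂ (inj₂ (inj₂ (refl , e)))) xn yn = Link-sym (subst (Link 1) (sym (trans (cong toC xe) (toC-odd m₁)))
      (inj₂ (inj₁ (inj₂ (m+m₁≡N , refl)))))
    where xe : x ≡ suc (m₁ + m₁)
          xe = suc-injective (trans e m+m≡)

  toC-toH : ∀ p → toC (toH p) ≡ p
  toC-toH p with side p
  ... | low l = trans (cong toC (toH-low l)) (toC-even p)
  ... | high k e = trans (cong toC (toH-high′ k e)) (trans (toC-odd k) e)

  toH-toC : ∀ x → x < n → toH (toC x) ≡ x
  toH-toC x xn with parity x
  ... | even k = trans (cong toH (toC-even k)) (toH-low (double-<-cancel {k} {m} xn))
  ... | odd k = trans (cong toH (toC-odd k)) (toH-high k)

  toH-<n : ∀ p → p ≤ N → toH p < n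
  toH-<n p pN with side p
  ... | low l = subst (_< n) (sym (toH-low l)) (+-mono-< l l)
  ... | high k refl = subst (_< n) (sym (toH-high k)) (≤-trans (≤-reflexive (cong suc (sym (+-suc k k)))) (+-mono-≤ kl kl))
    where
      kl : suc k ≤ m
      kl = s≤s (+-cancelˡ-≤ m k m₁ (≤-trans pN (≤-reflexive (sym m+m₁≡N))))

  toC-≤N : ∀ x → x < n → toC x ≤ N
  toC-≤N x xn with parity x
  ... | even k = subst (_≤ N) (sym (toC-even k)) (≤-trans (<⇒≤ (double-<-cancel xn)) m≤N)
  ... | odd k = subst (_≤ N) (sym (toC-odd k)) (≤-trans (+-monoʳ-≤ m (double-≤-cancel (≤-pred (≤-pred (subst (suc (suc (k + k)) ≤_) m+m≡ xn))))) (≤-reflexive m+m₁≡N))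

  π : Fin n → Fin n
  π p = fromℕ< (toH-<n (toℕ p) (toℕ≤N p))

  ψ : Fin n → Fin n
  ψ x = fromℕ< (s≤s (toC-≤N (toℕ x) (toℕ<n x)))

  toℕ-π : ∀ p → toℕ (π p) ≡ toH (toℕ p)
  toℕ-π p = toℕ-fromℕ< _

  toℕ-ψ : ∀ x → toℕ (ψ x) ≡ toC (toℕ x)
  toℕ-ψ x = toℕ-fromℕ< _

  π-ψ : ∀ x → π (ψ x) ≡ x
  π-ψ x = toℕ-injective (trans (toℕ-π (ψ x)) (trans (cong toH (toℕ-ψ x)) (toH-toC (toℕ x) (toℕ<n x))))

  π-injective : ∀ {p q} → π p ≡ π q → p ≡ q
  π-injective {p} {q} e = toℕ-injective (trans (sym (toC-toH (toℕ p))) (trans (cong toC (trans (sym (toℕ-π p)) (trans (cong toℕ e) (toℕ-π q)))) (toC-toH (toℕ q))))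

  4≤n : 4 ≤ n
  4≤n = ≤-trans (s≤s (s≤s (s≤s (s≤s z≤n)))) (+-mono-≤ (s≤s (≤-trans (s≤s z≤n) 3≤m₁)) (s≤s (≤-trans (s≤s z≤n) 3≤m₁)))

  π-adj : ∀ p q → edge n (π p) (π q) ≡ adj C p q
  π-adj p q = ⌊⌋-cong (Edge? _ _ _) (Link? _ _) (mk⇔
    (λ e → subst₂ Link (toC-toH (toℕ p)) (toC-toH (toℕ q))
             (Edge⇒Link (subst₂ (Edge n) (toℕ-π p) (toℕ-π q) e) (toH-<n _ (toℕ≤N p)) (toH-<n _ (toℕ≤N q))))
    (λ l → subst₂ (Edge n) (sym (toℕ-π p)) (sym (toℕ-π q)) (Link⇒Edge l)))

  H-toll-spanning : TollSpanning (H n 4≤n)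
  H-toll-spanning = TollSpanning-transport ψ π-ψ C-toll-spanning
    where open Transport C (H n 4≤n) π π-adj π-injective

  Dn-even-W : IsWStructure (Dn n)
  Dn-even-W = H n 4≤n , RealizesW-D (H n 4≤n) H-toll-spanning

theorem18 : ¬ Σ Sentence (λ σ → ∀ (n : ℕ) → 1 ≤ n → (D : TRel n) → Connected D →
                (IsWStructure D → D ⊨ σ) × (D ⊨ σ → IsWStructure D))
theorem18 (σ , defines) = OddCase.Dn-odd-not-W m (s≤s (s≤s z≤n)) odd-is-W
  where
    m₁ : ℕ
    m₁ = 4 + width (depth σ)
    m : ℕ
    m = suc m₁
    n : ℕ
    n = m + m
    open EvenCase m₁ (s≤s (s≤s (s≤s z≤n))) using (4≤n; Dn-even-W)
    even⊨σ : Dn n ⊨ σ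
    even⊨σ = proj₁ (defines n (s≤s z≤n) (Dn n) (Dn-connected 4≤n)) Dn-even-W
    odd⊨σ : Dn (suc n) ⊨ σ
    odd⊨σ = trans (sym (eval-Dn-suc σ (m≤m+n m m))) even⊨σ
    odd-is-W : IsWStructure (Dn (suc n))
    odd-is-W = proj₂ (defines (suc n) (s≤s z≤n) (Dn (suc n)) (Dn-connected (m≤n⇒m≤1+n 4≤n))) odd⊨σ
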